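{- Let $1<n\le m$. (1) $d^0_{n,m}=\binom{\lfloor\frac{m+n}{2}\rfloor+1}{2}+\binom{\lceil\frac{m-n}{2}\rceil+1}{2}$. (2) If moreover $n<m$ and $2\nmid(m-n)$, then $d^1_{n,m}=\binom{\lceil\frac{m+n}{2}\rceil+1}{2}+\binom{\lfloor\frac{m-n}{2}\rfloor+1}{2}-\lceil\frac{m+1}{2}\rceil$.
   Context: Elements of $\mathbb{Z}_n$ are identified with their smallest nonnegative representatives in $\{0,\dots,n-1\}$. The dYoke graph $Z_{n,m}$ has as vertices all tuples $u=(u_0,\dots,u_{m+1})$ with $u_0,u_{m+1}\in\mathbb{Z}_n$, $u_1,\dots,u_m\in\{ -1,0,1\}$ and $\sum_{i=0}^{m+1}u_i\equiv0\pmod n$; adjacency: there is $0\le i\le m$ with $u_j=v_j$ for $j\notin\{i,i+1\}$ and either ($u_i=v_i+1$, $u_{i+1}=v_{i+1}-1$) or ($u_i=v_i-1$, $u_{i+1}=v_{i+1}+1$), arithmetic in coordinates $0,m+1$ in $\mathbb{Z}_n$. $0$ is the all-zero vertex and $d$ is graph distance. $u^0_{n,m}$ is the vertex with $u_i=1$ for all $1\le i\le m$ and $u_0\equiv-\lfloor\frac{m-n}{2}\rfloor\pmod n$ (and $u_{m+1}$ determined by the sum condition); $d^0_{n,m}=d(u^0_{n,m},0)$. For $n<m$ with $m-n$ odd, $u^1_{n,m}$ is the vertex with $u_{\lceil (m+1)/2\rceil}=0$, $u_i=1$ for all other $1\le i\le m$, and $u_0\equiv-\lfloor\frac{m-n}{2}\rfloor\pmod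 n$; $d^1_{n,m}=d(u^1_{n,m},0)$. -}

module Defs where

open import Data.Bool using (if_then_else_)
open import Data.Nat as ℕ using (ℕ; zero; suc; _/_; _∸_; _≡ᵇ_)
open import Data.Integer as ℤ using (ℤ; +_; -_; _-_)
open import Data.Integer.DivMod using (_%ℕ_)
open import Data.Integer.Divisibility using (_∣_)
open import Data.Fin using (Fin; toℕ; inject₁) renaming (zero to fzero; suc to fsuc)
open import Data.Product using (Σ; _×_; ∃-syntax)
open import Data.Sum using (_⊎_)
open import Relation.Nullary using (¬_)
open import Relation.Binary.PropositionalEquality using (_≡_; _≢_)

-- All coordinates are stored as
-- integers; the coordinates u_0, u_{m+1} ∈ ℤ_n are identified with their
-- smallest nonnegative representatives in {0,…,n-1}.

Coords : ℕ → Set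
Coords m = Fin (suc (suc m)) → ℤ

IsEnd : (m : ℕ) → Fin (suc (suc m)) → Set
IsEnd m i = (toℕ i ≡ 0) ⊎ (toℕ i ≡ suc m)

sumF : ∀ {k} → (Fin k → ℤ) → ℤ
sumF {zero}  f = + 0
sumF {suc k} f = f fzero ℤ.+ sumF (λ i → f (fsuc i))

record IsVertex (n m : ℕ) (u : Coords m) : Set where
  field
    endRange : ∀ i → IsEnd m i → (+ 0 ℤ.≤ u i) × (u i ℤ.< + n)
    midRange : ∀ i → ¬ IsEnd m i → (ℤ.-1ℤ ℤ.≤ u i) × (u i ℤ.≤ + 1)
    sumZero  : (+ n) ∣ sumF u

CoordEq : (n m : ℕ) → Fin (suc (suc m)) → ℤ → ℤ → Set
CoordEq n m i a b = (IsEnd m i → (+ n) ∣ (a - b)) × (¬ IsEnd m i → a ≡ b)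

Adjacent : (n m : ℕ) → Coords m → Coords m → Set
Adjacent n m u v =
  ∃[ i ] ((∀ j → toℕ j ≢ toℕ (inject₁ i) → toℕ j ≢ toℕ (fsuc i) → u j ≡ v j)
         × ((CoordEq n m (inject₁ i) (u (inject₁ i)) (v (inject₁ i) ℤ.+ + 1)
             × CoordEq n m (fsuc i) (u (fsuc i)) (v (fsuc i) - + 1))
           ⊎ (CoordEq n m (inject₁ i) (u (inject₁ i)) (v (inject₁ i) - + 1)
             × CoordEq n m (fsuc i) (u (fsuc i)) (v (fsuc i) ℤ.+ + 1))))

data Walk (n m : ℕ) : Coords m → Coords m → ℕ → Set where
  here : ∀ {u} → IsVertex n m u → Walk n m u u 0
  step : ∀ {u v w k} → IsVertex n m u → Adjacent n m u v →
         Walk n m v w k → Walk n m u w (suc k)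

Dist : (n m : ℕ) → Coords m → Coords m → ℕ → Set
Dist n m u v k = Walk n m u v k × (∀ j → Walk n m u v j → k ℕ.≤ j)

-- reduction of an integer to its smallest nonnegative representative mod n
-- (the case n = 0 is never used)
modN : ℕ → ℤ → ℤ
modN zero    z = z
modN (suc k) z = + (z %ℕ suc k)

zeroV : (m : ℕ) → Coords m
zeroV m i = + 0

mkCoords : (m : ℕ) → ℤ → (ℕ → ℤ) → ℤ → Coords m
mkCoords m a mid b i =
  if toℕ i ≡ᵇ 0 then a else (if toℕ i ≡ᵇ suc m then b else mid (toℕ i))

-- u^0_{n,m}: u_i = 1 (1 ≤ i ≤ m), u_0 ≡ -⌊(m-n)/2⌋ (mod n),
-- u_{m+1} determined by the sum condition
u0-first : (n m : ℕ) → ℤ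
u0-first n m = modN n (- (+ ((m ∸ n) / 2)))

u⁰ : (n m : ℕ) → Coords m
u⁰ n m = mkCoords m a (λ _ → + 1) (modN n (- (a ℤ.+ + m)))
  where a = u0-first n m

d⁰ : (n m k : ℕ) → Set
d⁰ n m k = Dist n m (u⁰ n m) (zeroV m) k

-- u^1_{n,m}: u_{⌈(m+1)/2⌉} = 0, u_i = 1 for the other 1 ≤ i ≤ m,
-- u_0 ≡ -⌊(m-n)/2⌋ (mod n), u_{m+1} determined by the sum condition
-- (the middle coordinates sum to m - 1)
u¹ : (n m : ℕ) → Coords m
u¹ n m = mkCoords m a mid (modN n (- (a ℤ.+ + (m ∸ 1))))
  where
    a = u0-first n m
    mid : ℕ → ℤ
    mid i = if i ≡ᵇ ((m ℕ.+ 2) / 2) then + 0 else + 1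

d¹ : (n m k : ℕ) → Set
d¹ n m k = Dist n m (u¹ n m) (zeroV m) k

module Submission where

-- A vertex is encoded by heights s_0, …, s_m ∈ ℤ with consecutive differences in
-- {−1, 0, 1}: u_0 = s_0 mod n, u_i = s_i − s_{i−1}, u_{m+1} = −s_m mod n; changing one
-- s_p by ±1 is an edge.  Upper bound (Descent): moving a height of largest absolute
-- value towards 0 walks to the origin in Σ_t |s_t| steps.  Lower bound (Potential):
-- Σ_t |S_t − J·n|, with S_t = u_0 + … + u_t, changes by at most one per edge (after
-- adjusting J ∈ ℤ) and vanishes at the origin, so d ≥ min_J Σ_t |s_t − J·n|.  For u⁰
-- and u¹ the heights are t − B resp. plateau(t) − B with B = n + ⌊(m−n)/2⌋, and
-- convexity estimates for D N b = Σ_{t<N} |t − b| (two triangular numbers) show that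
-- J = 0 is optimal, so both bounds coincide.

open import Defs
open import Data.Nat using (ℕ; _+_; _/_; _∸_; _<_; _≤_; _%_)
open import Data.Nat.Combinatorics using (_C_)
open import Data.Product using (_×_)
open import Relation.Binary.PropositionalEquality using (_≢_)

open import Data.Bool using (true; false; if_then_else_)
open import Data.Nat using (zero; suc; _*_; z≤n; s≤s; _≡ᵇ_)
import Data.Nat as ℕ
import Data.Nat.Properties as ℕP
open import Data.Nat.DivMod using (m*n/n≡m; +-distrib-/; m*n%n≡0; m≡m%n+[m/n]*n; m%n<n)
open import Data.Nat.Combinatorics using (nCk+nC[k+1]≡[n+1]C[k+1]; nC1≡n)
open import Data.Integer as ℤ using (ℤ; +_; -[1+_])
  renaming (_+_ to _+ᶻ_; _-_ to _-ᶻ_; _*_ to _*ᶻ_; -_ to -ᶻ_)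
import Data.Integer.Properties as ℤP
open import Data.Integer.DivMod using (_%ℕ_; _/ℕ_; a≡a%ℕn+[a/ℕn]*n; n%ℕd<d)
import Data.Integer.Divisibility.Signed as Signed
open import Data.Integer.Divisibility using (_∣_)
open import Data.Fin using (Fin; toℕ; inject₁) renaming (zero to fzero; suc to fsuc)
import Data.Fin.Properties as FP
open import Data.Product using (_,_; proj₁; proj₂; ∃-syntax) renaming (map to ×-map)
open import Data.Sum using (_⊎_; inj₁; inj₂; [_,_]′) renaming (map to ⊎-map)
open import Data.Empty using (⊥; ⊥-elim)
open import Relation.Nullary using (¬_; yes; no)
open import Relation.Binary.PropositionalEquality
  using (_≡_; refl; sym; trans; cong; cong₂; subst; subst₂; _≗_; module ≡-Reasoning)
open import Relation.Binary.Definitions using (tri<; tri≈; tri>)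
open import Function using (_∘_)
import Data.Nat.Tactic.RingSolver as ℕSolver
import Data.Integer.Tactic.RingSolver as ℤSolver

∑ℕ : ℕ → (ℕ → ℕ) → ℕ
∑ℕ zero    f = 0
∑ℕ (suc N) f = ∑ℕ N f + f N

∑ℤ : ℕ → (ℕ → ℤ) → ℤ
∑ℤ zero    f = + 0
∑ℤ (suc N) f = ∑ℤ N f +ᶻ f N

∑ℕ-cong : ∀ N {f g} → (∀ t → t < N → f t ≡ g t) → ∑ℕ N f ≡ ∑ℕ N g
∑ℕ-cong zero    h = refl
∑ℕ-cong (suc N) h = cong₂ _+_ (∑ℕ-cong N (λ t t<N → h t (ℕP.m<n⇒m<1+n t<N))) (h N ℕP.≤-refl)

∑ℤ-cong : ∀ N {f g} → (∀ t → t < N → f t ≡ g t) → ∑ℤ N f ≡ ∑ℤ N g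
∑ℤ-cong zero    h = refl
∑ℤ-cong (suc N) h = cong₂ _+ᶻ_ (∑ℤ-cong N (λ t t<N → h t (ℕP.m<n⇒m<1+n t<N))) (h N ℕP.≤-refl)

∑ℕ-mono : ∀ N {f g} → (∀ t → t < N → f t ≤ g t) → ∑ℕ N f ≤ ∑ℕ N g
∑ℕ-mono zero    h = z≤n
∑ℕ-mono (suc N) h = ℕP.+-mono-≤ (∑ℕ-mono N (λ t t<N → h t (ℕP.m<n⇒m<1+n t<N))) (h N ℕP.≤-refl)

∑ℕ-zeros : ∀ N {f} → (∀ t → t < N → f t ≡ 0) → ∑ℕ N f ≡ 0
∑ℕ-zeros zero    h = refl
∑ℕ-zeros (suc N) h = cong₂ _+_ (∑ℕ-zeros N (λ t t<N → h t (ℕP.m<n⇒m<1+n t<N))) (h N ℕP.≤-refl)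

∑ℕ≡0⇒zeros : ∀ N {f} → ∑ℕ N f ≡ 0 → ∀ t → t < N → f t ≡ 0
∑ℕ≡0⇒zeros (suc N) {f} e t t<1+N with t ℕP.≟ N
... | yes refl = ℕP.m+n≡0⇒n≡0 (∑ℕ N f) e
... | no t≢N   = ∑ℕ≡0⇒zeros N (ℕP.m+n≡0⇒m≡0 (∑ℕ N f) e) t (ℕP.≤∧≢⇒< (ℕP.≤-pred t<1+N) t≢N)

∑ℕ-change : ∀ N p {f g} → p < N → (∀ t → t < N → t ≢ p → f t ≡ g t) →
            ∑ℕ N f + g p ≡ ∑ℕ N g + f p
∑ℕ-change (suc N) p {f} {g} p<1+N agree with p ℕP.≟ N
... | yes refl = begin
  ∑ℕ N f + f N + g N ≡⟨ cong (λ x → x + f N + g N) (∑ℕ-cong N (λ t t<N → below t t<N (ℕP.<⇒≢ t<N))) ⟩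
  ∑ℕ N g + f N + g N ≡⟨ swap (∑ℕ N g) (f N) (g N) ⟩
  ∑ℕ N g + g N + f N ∎
  where
  open ≡-Reasoning
  swap : ∀ a b c → a + b + c ≡ a + c + b
  swap = ℕSolver.solve-∀
  below : ∀ t → t < N → t ≢ N → f t ≡ g t
  below t t<N = agree t (ℕP.m<n⇒m<1+n t<N)
... | no p≢N = begin
  ∑ℕ N f + f N + g p ≡⟨ swap (∑ℕ N f) (f N) (g p) ⟩
  ∑ℕ N f + g p + f N ≡⟨ cong₂ _+_ (∑ℕ-change N p p<N below) (agree N ℕP.≤-refl (p≢N ∘ sym)) ⟩
  ∑ℕ N g + f p + g N ≡⟨ swap (∑ℕ N g) (f p) (g N) ⟩
  ∑ℕ N g + g N + f p ∎
  where
  open ≡-Reasoning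
  swap : ∀ a b c → a + b + c ≡ a + c + b
  swap = ℕSolver.solve-∀
  p<N : p < N
  p<N = ℕP.≤∧≢⇒< (ℕP.≤-pred p<1+N) p≢N
  below : ∀ t → t < N → t ≢ p → f t ≡ g t
  below t t<N = agree t (ℕP.m<n⇒m<1+n t<N)

∑ℕ-raise : ∀ N p {f g} → p < N → (∀ t → t < N → t ≢ p → f t ≡ g t) →
           f p ≡ suc (g p) → ∑ℕ N f ≡ suc (∑ℕ N g)
∑ℕ-raise N p {f} {g} p<N agree fp = ℕP.+-cancelʳ-≡ (g p) (∑ℕ N f) (suc (∑ℕ N g))
  (trans (∑ℕ-change N p p<N agree) (trans (cong (ℕ._+_ (∑ℕ N g)) fp) (ℕP.+-suc (∑ℕ N g) (g p))))

∑ℕ-raise-≤ : ∀ N p {f g} → p < N → (∀ t → t < N → t ≢ p → f t ≡ g t) →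
             f p ≤ suc (g p) → ∑ℕ N f ≤ suc (∑ℕ N g)
∑ℕ-raise-≤ N p {f} {g} p<N agree fp = ℕP.+-cancelʳ-≤ (g p) (∑ℕ N f) (suc (∑ℕ N g)) (begin
  ∑ℕ N f + g p       ≡⟨ ∑ℕ-change N p p<N agree ⟩
  ∑ℕ N g + f p       ≤⟨ ℕP.+-monoʳ-≤ (∑ℕ N g) fp ⟩
  ∑ℕ N g + suc (g p) ≡⟨ ℕP.+-suc (∑ℕ N g) (g p) ⟩
  suc (∑ℕ N g) + g p ∎)
  where open ℕP.≤-Reasoning

∑ℤ-head : ∀ N F → ∑ℤ (suc N) F ≡ F 0 +ᶻ ∑ℤ N (λ t → F (suc t))
∑ℤ-head zero    F = ℤP.+-comm (+ 0) (F 0)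
∑ℤ-head (suc N) F = begin
  ∑ℤ (suc N) F +ᶻ F (suc N)                     ≡⟨ cong (_+ᶻ F (suc N)) (∑ℤ-head N F) ⟩
  (F 0 +ᶻ ∑ℤ N (λ t → F (suc t))) +ᶻ F (suc N)  ≡⟨ ℤP.+-assoc (F 0) _ _ ⟩
  F 0 +ᶻ (∑ℤ N (λ t → F (suc t)) +ᶻ F (suc N))  ∎
  where open ≡-Reasoning

tri : ℕ → ℕ
tri x = suc x C 2

tri-suc : ∀ x → tri (suc x) ≡ tri x + suc x
tri-suc x = begin
  tri (suc x)                 ≡⟨ nCk+nC[k+1]≡[n+1]C[k+1] (suc x) 1 ⟨
  suc x C 1 + tri x           ≡⟨ cong (_+ tri x) (nC1≡n (suc x)) ⟩
  suc x + tri x               ≡⟨ ℕP.+-comm (suc x) (tri x) ⟩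
  tri x + suc x               ∎
  where open ≡-Reasoning

tri-spread : ∀ a b k → b ≤ a → tri (b + k) + tri a ≤ tri b + tri (a + k)
tri-spread a b zero b≤a = ℕP.≤-reflexive (cong₂ (λ x y → tri x + tri y) (ℕP.+-identityʳ b) (sym (ℕP.+-identityʳ a)))
tri-spread a b (suc k) b≤a = begin
  tri (b + suc k) + tri a             ≡⟨ cong (λ z → tri z + tri a) (ℕP.+-suc b k) ⟩
  tri (suc (b + k)) + tri a           ≡⟨ cong (_+ tri a) (tri-suc (b + k)) ⟩
  tri (b + k) + suc (b + k) + tri a   ≡⟨ swap (tri (b + k)) (suc (b + k)) (tri a) ⟩
  tri (b + k) + tri a + suc (b + k)   ≤⟨ ℕP.+-mono-≤ (tri-spread a b k b≤a) (s≤s (ℕP.+-monoˡ-≤ k b≤a)) ⟩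
  tri b + tri (a + k) + suc (a + k)   ≡⟨ ℕP.+-assoc (tri b) _ _ ⟩
  tri b + (tri (a + k) + suc (a + k)) ≡⟨ cong (ℕ._+_ (tri b)) (tri-suc (a + k)) ⟨
  tri b + tri (suc (a + k))           ≡⟨ cong (λ z → tri b + tri z) (ℕP.+-suc a k) ⟨
  tri b + tri (a + suc k)             ∎
  where
  open ℕP.≤-Reasoning
  swap : ∀ x y z → x + y + z ≡ x + z + y
  swap = ℕSolver.solve-∀

tri-pair-bound : ∀ L R x y → x ≤ L → x ≤ R → x + y ≡ L + R → tri L + tri R ≤ tri x + tri y
tri-pair-bound L R x y x≤L x≤R sum =
  [ (λ L≤R → ordered L R x≤L L≤R sum)
  , (λ R≤L → subst (_≤ tri x + tri y) (ℕP.+-comm (tri R) (tri L))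
                   (ordered R L x≤R R≤L (trans sum (ℕP.+-comm L R)))) ]′ (ℕP.≤-total L R)
  where
  ordered : ∀ L R → x ≤ L → L ≤ R → x + y ≡ L + R → tri L + tri R ≤ tri x + tri y
  ordered L R x≤L L≤R sum = begin
    tri L + tri R             ≡⟨ cong (λ z → tri z + tri R) (ℕP.m+[n∸m]≡n x≤L) ⟨
    tri (x + (L ∸ x)) + tri R ≤⟨ tri-spread R x (L ∸ x) (ℕP.≤-trans x≤L L≤R) ⟩
    tri x + tri (R + (L ∸ x)) ≡⟨ cong (λ z → tri x + tri z) (ℕP.+-cancelˡ-≡ x _ _ moved) ⟩
    tri x + tri y             ∎
    where
    open ℕP.≤-Reasoning
    rotate : ∀ a b c → a + (b + c) ≡ b + (a + c)
    rotate = ℕSolver.solve-∀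
    moved : x + (R + (L ∸ x)) ≡ x + y
    moved = trans (rotate x R (L ∸ x))
              (trans (cong (ℕ._+_ R) (ℕP.m+[n∸m]≡n x≤L)) (trans (ℕP.+-comm R L) (sym sum)))

D : ℕ → ℕ → ℕ
D N b = ∑ℕ N (λ t → ℕ.∣ t - b ∣)

D-shift : ∀ N b → N ≤ suc b → D N (suc b) ≡ D N b + N
D-shift zero    b N≤1+b = refl
D-shift (suc N) b N<1+b = begin
  D N (suc b) + ℕ.∣ N - suc b ∣      ≡⟨ cong₂ _+_ (D-shift N b (ℕP.m≤n⇒m≤1+n N≤b)) (oneFurther N b N≤b) ⟩
  D N b + N + suc ℕ.∣ N - b ∣        ≡⟨ swap (D N b) N ℕ.∣ N - b ∣ ⟩
  D N b + ℕ.∣ N - b ∣ + suc N        ∎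
  where
  open ≡-Reasoning
  N≤b : N ≤ b
  N≤b = ℕP.≤-pred N<1+b
  swap : ∀ x y z → x + y + suc z ≡ x + z + suc y
  swap = ℕSolver.solve-∀
  oneFurther : ∀ t b → t ≤ b → ℕ.∣ t - suc b ∣ ≡ suc ℕ.∣ t - b ∣
  oneFurther t b t≤b = begin
    ℕ.∣ t - suc b ∣ ≡⟨ ℕP.m≤n⇒∣m-n∣≡n∸m (ℕP.m≤n⇒m≤1+n t≤b) ⟩
    suc b ∸ t       ≡⟨ ℕP.+-∸-assoc 1 t≤b ⟩
    suc (b ∸ t)     ≡⟨ cong suc (ℕP.m≤n⇒∣m-n∣≡n∸m t≤b) ⟨
    suc ℕ.∣ t - b ∣ ∎

D-grow : ∀ N b k → N ≤ suc b → D N b ≤ D N (b + k)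
D-grow N b zero    N≤1+b = ℕP.≤-reflexive (cong (D N) (sym (ℕP.+-identityʳ b)))
D-grow N b (suc k) N≤1+b = begin
  D N b             ≤⟨ D-grow N b k N≤1+b ⟩
  D N (b + k)       ≤⟨ ℕP.m≤m+n (D N (b + k)) N ⟩
  D N (b + k) + N   ≡⟨ D-shift N (b + k) (ℕP.≤-trans N≤1+b (s≤s (ℕP.m≤m+n b k))) ⟨
  D N (suc (b + k)) ≡⟨ cong (D N) (ℕP.+-suc b k) ⟨
  D N (b + suc k)   ∎
  where open ℕP.≤-Reasoning

D-closed : ∀ b k → D (suc (b + k)) b ≡ tri b + tri k
D-closed b zero = trans (cong (λ z → D (suc z) b) (ℕP.+-identityʳ b)) (trans (atEnd b) (sym (ℕP.+-identityʳ (tri b))))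
  where
  atEnd : ∀ b → D (suc b) b ≡ tri b
  atEnd zero    = refl
  atEnd (suc b) = begin
    D (suc b) (suc b) + ℕ.∣ suc b - suc b ∣ ≡⟨ cong₂ _+_ (D-shift (suc b) b ℕP.≤-refl) (ℕP.∣n-n∣≡0 b) ⟩
    D (suc b) b + suc b + 0                 ≡⟨ ℕP.+-identityʳ _ ⟩
    D (suc b) b + suc b                     ≡⟨ cong (_+ suc b) (atEnd b) ⟩
    tri b + suc b                           ≡⟨ tri-suc b ⟨
    tri (suc b)                             ∎
    where open ≡-Reasoning
D-closed b (suc k) = begin
  D (suc (b + suc k)) b                     ≡⟨ cong (λ z → D (suc z) b) (ℕP.+-suc b k) ⟩
  D (suc (b + k)) b + ℕ.∣ suc (b + k) - b ∣ ≡⟨ cong₂ _+_ (D-closed b k) lastTerm ⟩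
  tri b + tri k + suc k                     ≡⟨ ℕP.+-assoc (tri b) (tri k) (suc k) ⟩
  tri b + (tri k + suc k)                   ≡⟨ cong (ℕ._+_ (tri b)) (tri-suc k) ⟨
  tri b + tri (suc k)                       ∎
  where
  open ≡-Reasoning
  lastTerm : ℕ.∣ suc (b + k) - b ∣ ≡ suc k
  lastTerm = trans (ℕP.∣-∣-comm (suc (b + k)) b)
               (trans (cong (λ z → ℕ.∣ b - z ∣) (sym (ℕP.+-suc b k))) (ℕP.∣m-m+n∣≡n b (suc k)))

-- D (L + R + 1) b ≥ tri L + tri R whenever b lies outside the interval
-- between L and R: the minimum of D is attained near the median.
D-bound-left : ∀ L R b → b ≤ L → b ≤ R → tri L + tri R ≤ D (suc (L + R)) b
D-bound-left L R b b≤L b≤R = begin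
  tri L + tri R               ≤⟨ tri-pair-bound L R b (L + R ∸ b) b≤L b≤R split ⟩
  tri b + tri (L + R ∸ b)     ≡⟨ D-closed b (L + R ∸ b) ⟨
  D (suc (b + (L + R ∸ b))) b ≡⟨ cong (λ z → D (suc z) b) split ⟩
  D (suc (L + R)) b           ∎
  where
  open ℕP.≤-Reasoning
  split : b + (L + R ∸ b) ≡ L + R
  split = ℕP.m+[n∸m]≡n (ℕP.≤-trans b≤L (ℕP.m≤m+n L R))

D-bound-right : ∀ L R b → L ≤ b → R ≤ b → tri L + tri R ≤ D (suc (L + R)) b
D-bound-right L R b L≤b R≤b = [ inside b L≤b R≤b , beyond ]′ (ℕP.≤-total b (L + R))
  where
  inside : ∀ b → L ≤ b → R ≤ b → b ≤ L + R → tri L + tri R ≤ D (suc (L + R)) b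
  inside b L≤b R≤b b≤L+R = begin
    tri L + tri R               ≤⟨ tri-pair-bound L R x b x≤L x≤R (trans (ℕP.+-comm x b) split) ⟩
    tri x + tri b               ≡⟨ ℕP.+-comm (tri x) (tri b) ⟩
    tri b + tri x               ≡⟨ D-closed b x ⟨
    D (suc (b + x)) b           ≡⟨ cong (λ z → D (suc z) b) split ⟩
    D (suc (L + R)) b           ∎
    where
    open ℕP.≤-Reasoning
    x : ℕ
    x = L + R ∸ b
    split : b + x ≡ L + R
    split = ℕP.m+[n∸m]≡n b≤L+R
    x≤L : x ≤ L
    x≤L = ℕP.≤-trans (ℕP.∸-monoʳ-≤ (L + R) R≤b) (ℕP.≤-reflexive (ℕP.m+n∸n≡m L R))
    x≤R : x ≤ R
    x≤R = ℕP.≤-trans (ℕP.∸-monoʳ-≤ (L + R) L≤b) (ℕP.≤-reflexive (ℕP.m+n∸m≡n L R))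
  beyond : L + R ≤ b → tri L + tri R ≤ D (suc (L + R)) b
  beyond L+R≤b = begin
    tri L + tri R                           ≤⟨ inside (L + R) (ℕP.m≤m+n L R) (ℕP.m≤n+m R L) ℕP.≤-refl ⟩
    D (suc (L + R)) (L + R)                 ≤⟨ D-grow (suc (L + R)) (L + R) (b ∸ (L + R)) ℕP.≤-refl ⟩
    D (suc (L + R)) (L + R + (b ∸ (L + R))) ≡⟨ cong (D (suc (L + R))) (ℕP.m+[n∸m]≡n L+R≤b) ⟩
    D (suc (L + R)) b                       ∎
    where open ℕP.≤-Reasoning

tri-positive : ∀ x → 1 ≤ tri (suc x)
tri-positive x = subst (1 ≤_) (sym (tri-suc x)) (ℕP.≤-trans (s≤s z≤n) (ℕP.m≤n+m (suc x) (tri x)))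

plateau : ℕ → ℕ → ℕ
plateau h t with t ℕP.≤? h
... | yes _ = t
... | no  _ = t ∸ 1

plateau-≤ : ∀ h t → t ≤ h → plateau h t ≡ t
plateau-≤ h t t≤h with t ℕP.≤? h
... | yes _   = refl
... | no  t≰h = ⊥-elim (t≰h t≤h)

plateau-> : ∀ h t → h < t → plateau h t ≡ t ∸ 1
plateau-> h t h<t with t ℕP.≤? h
... | yes t≤h = ⊥-elim (ℕP.<⇒≱ h<t t≤h)
... | no  _   = refl

plateau-repeat : ∀ h → plateau h (suc h) ≡ plateau h h
plateau-repeat h = trans (plateau-> h (suc h) ℕP.≤-refl) (sym (plateau-≤ h h ℕP.≤-refl))

plateau-climb : ∀ h t → t ≢ h → plateau h (suc t) ≡ suc (plateau h t)
plateau-climb h t t≢h with ℕP.<-cmp t h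
... | tri< t<h _ _  = trans (plateau-≤ h (suc t) t<h) (cong suc (sym (plateau-≤ h t (ℕP.<⇒≤ t<h))))
... | tri≈ _ t≡h _  = ⊥-elim (t≢h t≡h)
... | tri> _ _ h<t  = trans (plateau-> h (suc t) (ℕP.m<n⇒m<1+n h<t)) (sym (trans (cong suc (plateau-> h t h<t)) (suc-pred h<t)))
  where
  suc-pred : ∀ {t} → h < t → suc (t ∸ 1) ≡ t
  suc-pred {suc t} _ = refl

plateau-D : ∀ h N b → h < N → ∑ℕ (suc N) (λ t → ℕ.∣ plateau h t - b ∣) ≡ D N b + ℕ.∣ h - b ∣
plateau-D h (suc N) b h<1+N with ℕP.m≤n⇒m<n∨m≡n (ℕP.≤-pred h<1+N)
... | inj₂ refl = cong₂ _+_
      (∑ℕ-cong (suc h) (λ t t<1+h → cong (λ z → ℕ.∣ z - b ∣) (plateau-≤ h t (ℕP.≤-pred t<1+h))))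
      (cong (λ z → ℕ.∣ z - b ∣) (trans (plateau-repeat h) (plateau-≤ h h ℕP.≤-refl)))
... | inj₁ h<N = begin
  ∑ℕ (suc N) F + F (suc N)                   ≡⟨ cong₂ _+_ (plateau-D h N b h<N) lastTerm ⟩
  D N b + ℕ.∣ h - b ∣ + ℕ.∣ N - b ∣          ≡⟨ swap (D N b) ℕ.∣ h - b ∣ ℕ.∣ N - b ∣ ⟩
  D N b + ℕ.∣ N - b ∣ + ℕ.∣ h - b ∣          ∎
  where
  open ≡-Reasoning
  F : ℕ → ℕ
  F t = ℕ.∣ plateau h t - b ∣
  lastTerm : F (suc N) ≡ ℕ.∣ N - b ∣
  lastTerm = cong (λ z → ℕ.∣ z - b ∣) (plateau-> h (suc N) (ℕP.m<n⇒m<1+n h<N))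
  swap : ∀ x y z → x + y + z ≡ x + z + y
  swap = ℕSolver.solve-∀

∣+a-+b∣ : ∀ a b → ℤ.∣ + a -ᶻ + b ∣ ≡ ℕ.∣ a - b ∣
∣+a-+b∣ a b with ℕP.≤-total a b
... | inj₁ a≤b = trans (cong ℤ.∣_∣ (ℤP.m-n≡m⊖n a b))
                 (trans (ℤP.∣⊖∣-≤ a≤b) (sym (ℕP.m≤n⇒∣m-n∣≡n∸m a≤b)))
... | inj₂ b≤a = trans (cong ℤ.∣_∣ (ℤP.m-n≡m⊖n a b)) (trans (ℤP.∣m⊖n∣≡∣n⊖m∣ a b)
                 (trans (ℤP.∣⊖∣-≤ b≤a) (sym (ℕP.m≤n⇒∣n-m∣≡n∸m b≤a))))

≡ᵇ-refl : ∀ j → (j ≡ᵇ j) ≡ true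
≡ᵇ-refl zero    = refl
≡ᵇ-refl (suc j) = ≡ᵇ-refl j

≡ᵇ-≢ : ∀ j k → j ≢ k → (j ≡ᵇ k) ≡ false
≡ᵇ-≢ zero    zero    j≢k = ⊥-elim (j≢k refl)
≡ᵇ-≢ zero    (suc k) _   = refl
≡ᵇ-≢ (suc j) zero    _   = refl
≡ᵇ-≢ (suc j) (suc k) j≢k = ≡ᵇ-≢ j k (j≢k ∘ cong suc)

argmax : ∀ (f : ℕ → ℕ) N → ∃[ p ] (p ≤ N × (∀ t → t ≤ N → f t ≤ f p))
argmax f zero = 0 , z≤n , λ { zero _ → ℕP.≤-refl }
argmax f (suc N) with argmax f N
... | p , p≤N , isMax with ℕP.≤-total (f (suc N)) (f p)
...   | inj₁ last≤ = p , ℕP.m≤n⇒m≤1+n p≤N , bound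
  where
  bound : ∀ t → t ≤ suc N → f t ≤ f p
  bound t t≤1+N with t ℕP.≟ suc N
  ... | yes refl = last≤
  ... | no  t≢   = isMax t (ℕP.≤-pred (ℕP.≤∧≢⇒< t≤1+N t≢))
...   | inj₂ ≤last = suc N , ℕP.≤-refl , bound
  where
  bound : ∀ t → t ≤ suc N → f t ≤ f (suc N)
  bound t t≤1+N with t ℕP.≟ suc N
  ... | yes refl = ℕP.≤-refl
  ... | no  t≢   = ℕP.≤-trans (isMax t (ℕP.≤-pred (ℕP.≤∧≢⇒< t≤1+N t≢))) ≤last

-- Equality of naturals decided as a plain sum; unlike a `with` on _≟_, a `with`
-- on it does not also unfold the comparisons made inside `update` below.
≡-or-≢ : ∀ (a b : ℕ) → (a ≡ b) ⊎ (a ≢ b)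
≡-or-≢ a b with a ℕP.≟ b
... | yes a≡b = inj₁ a≡b
... | no  a≢b = inj₂ a≢b

update : (ℕ → ℤ) → ℕ → ℤ → ℕ → ℤ
update s p x t with t ℕP.≟ p
... | yes _ = x
... | no  _ = s t

update-at : ∀ s p x → update s p x p ≡ x
update-at s p x with p ℕP.≟ p
... | yes _   = refl
... | no  p≢p = ⊥-elim (p≢p refl)

update-away : ∀ s p x t → t ≢ p → update s p x t ≡ s t
update-away s p x t t≢p with t ℕP.≟ p
... | yes t≡p = ⊥-elim (t≢p t≡p)
... | no  _   = refl

sign-cases : ∀ v → (+ 1 ℤ.≤ v) ⊎ (v ≡ + 0) ⊎ (v ℤ.≤ ℤ.-1ℤ)
sign-cases (+ zero)  = inj₂ (inj₁ refl)
sign-cases (+ suc a) = inj₁ (ℤ.+≤+ (s≤s z≤n))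
sign-cases -[1+ a ]  = inj₂ (inj₂ (ℤ.-≤- z≤n))

abs-dominates-pos : ∀ x y → ℤ.∣ x ∣ ≤ ℤ.∣ y ∣ → + 1 ℤ.≤ y → x ℤ.≤ y
abs-dominates-pos (+ a)    (+ b) a≤b _ = ℤ.+≤+ a≤b
abs-dominates-pos -[1+ a ] (+ b) _   _ = ℤ.-≤+
abs-dominates-pos x        -[1+ b ] _ ()

abs-dominates-neg : ∀ x y → ℤ.∣ x ∣ ≤ ℤ.∣ y ∣ → y ℤ.≤ ℤ.-1ℤ → y ℤ.≤ x
abs-dominates-neg (+ a)    -[1+ b ] _     _ = ℤ.-≤+
abs-dominates-neg -[1+ a ] -[1+ b ] a+1≤b+1 _ = ℤ.-≤- (ℕP.≤-pred a+1≤b+1)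
abs-dominates-neg x        (+ b)    _     ()

abs-toward0-pos : ∀ y → + 1 ℤ.≤ y → ℤ.∣ y ∣ ≡ suc ℤ.∣ y -ᶻ + 1 ∣
abs-toward0-pos (+ suc a) _          = refl
abs-toward0-pos (+ zero)  (ℤ.+≤+ ())

abs-toward0-neg : ∀ y → y ℤ.≤ ℤ.-1ℤ → ℤ.∣ y ∣ ≡ suc ℤ.∣ y +ᶻ + 1 ∣
abs-toward0-neg -[1+ zero ]  _ = refl
abs-toward0-neg -[1+ suc b ] _ = refl

Step : ℤ → ℤ → Set
Step x y = (y ≡ x) ⊎ (y ≡ x +ᶻ + 1) ⊎ (x ≡ y +ᶻ + 1)

UnitRange : ℤ → Set
UnitRange d = (ℤ.-1ℤ ℤ.≤ d) × (d ℤ.≤ + 1)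

step-difference : ∀ {x y} → Step x y → UnitRange (y -ᶻ x)
step-difference {x}     (inj₁ refl)        = subst UnitRange (sym (ℤP.+-inverseʳ x)) (ℤ.-≤+ , ℤ.+≤+ z≤n)
step-difference {x}     (inj₂ (inj₁ refl)) = subst UnitRange (sym (up x)) (ℤ.-≤+ , ℤ.+≤+ (s≤s z≤n))
  where
  up : ∀ x → (x +ᶻ + 1) -ᶻ x ≡ + 1
  up = ℤSolver.solve-∀
step-difference {y = y} (inj₂ (inj₂ refl)) = subst UnitRange (sym (down y)) (ℤ.-≤- z≤n , ℤ.-≤+)
  where
  down : ∀ y → y -ᶻ (y +ᶻ + 1) ≡ ℤ.-1ℤ
  down = ℤSolver.solve-∀

step-sym : ∀ {x y} → Step x y → Step y x
step-sym (inj₁ refl)        = inj₁ refl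
step-sym (inj₂ (inj₁ refl)) = inj₂ (inj₂ refl)
step-sym (inj₂ (inj₂ refl)) = inj₂ (inj₁ refl)

succ≰ : ∀ x → ¬ (x +ᶻ + 1 ℤ.≤ x)
succ≰ x x+1≤x = ℤP.<-irrefl refl (ℤP.suc[i]≤j⇒i<j (subst (ℤ._≤ x) (ℤP.+-comm x (+ 1)) x+1≤x))

step-lower : ∀ {x y} → Step x y → x ℤ.≤ y → Step x (y -ᶻ + 1)
step-lower {x}     (inj₁ refl)        _      = inj₂ (inj₂ (back x))
  where
  back : ∀ x → x ≡ (x -ᶻ + 1) +ᶻ + 1
  back = ℤSolver.solve-∀
step-lower {x}     (inj₂ (inj₁ refl)) _      = inj₁ (forth x)
  where
  forth : ∀ x → (x +ᶻ + 1) -ᶻ + 1 ≡ x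
  forth = ℤSolver.solve-∀
step-lower {y = y} (inj₂ (inj₂ refl)) y+1≤y = ⊥-elim (succ≰ y y+1≤y)

step-raise : ∀ {x y} → Step x y → y ℤ.≤ x → Step x (y +ᶻ + 1)
step-raise         (inj₁ refl)        _      = inj₂ (inj₁ refl)
step-raise {x}     (inj₂ (inj₁ refl)) x+1≤x = ⊥-elim (succ≰ x x+1≤x)
step-raise         (inj₂ (inj₂ refl)) _      = inj₁ refl

module Residues (n₁ : ℕ) where

  n : ℕ
  n = suc n₁

  multiple⇒∣ : ∀ x q → x ≡ q *ᶻ + n → (+ n) ∣ x
  multiple⇒∣ x q x≡qn = Signed.∣⇒∣ᵤ (Signed.divides q x≡qn)

  ∣⇒congruent : ∀ x y → (+ n) ∣ (x -ᶻ y) → ∃[ c ] x ≡ y +ᶻ c *ᶻ + n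
  ∣⇒congruent x y n∣x-y with Signed.∣ᵤ⇒∣ n∣x-y
  ... | Signed.divides q x-y≡qn = q , trans (split x y) (cong (y +ᶻ_) x-y≡qn)
    where
    split : ∀ x y → x ≡ y +ᶻ (x -ᶻ y)
    split = ℤSolver.solve-∀

  residue-unique : ∀ r₁ r₂ c → r₁ < n → r₂ < n → + r₁ ≡ + r₂ +ᶻ c *ᶻ + n → r₁ ≡ r₂
  residue-unique r₁ r₂ (+ zero)  _    _    e = cong ℤ.∣_∣ (trans e (ℤP.+-identityʳ (+ r₂)))
  residue-unique r₁ r₂ (+ suc k) r₁<n _    e = ⊥-elim (tooFar r₁ r₂ k r₁<n e)
    where
    tooFar : ∀ r₁ r₂ k → r₁ < n → + r₁ ≡ + r₂ +ᶻ + suc k *ᶻ + n → ⊥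
    tooFar r₁ r₂ k r₁<n e = ℕP.<-irrefl refl (ℕP.<-≤-trans r₁<n (begin
      n                 ≤⟨ ℕP.m≤n*m n (suc k) ⟩
      suc k * n         ≤⟨ ℕP.m≤n+m (suc k * n) r₂ ⟩
      r₂ + suc k * n    ≡⟨ cong ℤ.∣_∣ e ⟨
      r₁                ∎))
      where open ℕP.≤-Reasoning
  residue-unique r₁ r₂ -[1+ k ] r₁<n r₂<n e = sym (residue-unique r₂ r₁ (+ suc k) r₂<n r₁<n (flip e))
    where
    flip : + r₁ ≡ + r₂ +ᶻ -[1+ k ] *ᶻ + n → + r₂ ≡ + r₁ +ᶻ + suc k *ᶻ + n
    flip e = trans (undo (+ r₂) (+ suc k) (+ n)) (cong (_+ᶻ + suc k *ᶻ + n) (sym e))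
      where
      undo : ∀ y P N → y ≡ (y +ᶻ (-ᶻ P) *ᶻ N) +ᶻ P *ᶻ N
      undo = ℤSolver.solve-∀

  modN-range : ∀ z → (+ 0 ℤ.≤ modN n z) × (modN n z ℤ.< + n)
  modN-range z = ℤ.+≤+ z≤n , ℤ.+<+ (n%ℕd<d z n)

  modN-rem : ∀ z → modN n z ≡ z -ᶻ (z /ℕ n) *ᶻ + n
  modN-rem z = trans (cancel (modN n z) (z /ℕ n) (+ n)) (cong (_-ᶻ (z /ℕ n) *ᶻ + n) (sym (a≡a%ℕn+[a/ℕn]*n z n)))
    where
    cancel : ∀ r a N → r ≡ (r +ᶻ a *ᶻ N) -ᶻ a *ᶻ N
    cancel = ℤSolver.solve-∀

  modN-shift : ∀ x y d → x ≡ y +ᶻ d →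
               modN n x ≡ (modN n y +ᶻ d) +ᶻ ((y /ℕ n) -ᶻ (x /ℕ n)) *ᶻ + n
  modN-shift x y d x≡y+d = begin
    modN n x                              ≡⟨ modN-rem x ⟩
    x -ᶻ a *ᶻ N                           ≡⟨ cong (_-ᶻ a *ᶻ N) x≡y+d ⟩
    (y +ᶻ d) -ᶻ a *ᶻ N                    ≡⟨ regroup y b d a N ⟩
    ((y -ᶻ b *ᶻ N) +ᶻ d) +ᶻ (b -ᶻ a) *ᶻ N ≡⟨ cong (λ r → (r +ᶻ d) +ᶻ (b -ᶻ a) *ᶻ N) (modN-rem y) ⟨
    (modN n y +ᶻ d) +ᶻ (b -ᶻ a) *ᶻ N      ∎
    where
    open ≡-Reasoning
    N a b : ℤ
    N = + n
    a = x /ℕ n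
    b = y /ℕ n
    regroup : ∀ y b d a N → (y +ᶻ d) -ᶻ a *ᶻ N ≡ ((y -ᶻ b *ᶻ N) +ᶻ d) +ᶻ (b -ᶻ a) *ᶻ N
    regroup = ℤSolver.solve-∀

  modN-cong : ∀ x y q → x ≡ y +ᶻ q *ᶻ + n → modN n x ≡ modN n y
  modN-cong x y q x≡y+qn = cong +_ (residue-unique (x %ℕ n) (y %ℕ n) c (n%ℕd<d x n) (n%ℕd<d y n)
    (trans (modN-shift x y (q *ᶻ + n) x≡y+qn) (regroup (modN n y) q ((y /ℕ n) -ᶻ (x /ℕ n)) (+ n))))
    where
    c : ℤ
    c = q +ᶻ ((y /ℕ n) -ᶻ (x /ℕ n))
    regroup : ∀ r q c N → (r +ᶻ q *ᶻ N) +ᶻ c *ᶻ N ≡ r +ᶻ (q +ᶻ c) *ᶻ N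
    regroup = ℤSolver.solve-∀

  modN-shift-∣ : ∀ x y d → x ≡ y +ᶻ d → (+ n) ∣ (modN n x -ᶻ (modN n y +ᶻ d))
  modN-shift-∣ x y d x≡y+d = multiple⇒∣ _ c
    (trans (cong (_-ᶻ (modN n y +ᶻ d)) (modN-shift x y d x≡y+d)) (cancel (modN n y +ᶻ d) (c *ᶻ + n)))
    where
    c : ℤ
    c = (y /ℕ n) -ᶻ (x /ℕ n)
    cancel : ∀ A M → (A +ᶻ M) -ᶻ A ≡ M
    cancel = ℤSolver.solve-∀

  -- −e and −(n + e) have the same residue; this fixes the first coordinate of u⁰ and u¹ ...
  residue-start : ∀ e → modN n (-ᶻ + e) ≡ modN n (+ 0 -ᶻ + (n + e))
  residue-start e = modN-cong (-ᶻ + e) (+ 0 -ᶻ + (n + e)) (+ 1) (addN (+ e) (+ n))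
    where
    addN : ∀ E N → -ᶻ E ≡ (+ 0 -ᶻ (N +ᶻ E)) +ᶻ + 1 *ᶻ N
    addN = ℤSolver.solve-∀

  residue-end : ∀ e M → modN n (-ᶻ (modN n (-ᶻ + e) +ᶻ + M)) ≡ modN n (-ᶻ (+ M -ᶻ + (n + e)))
  residue-end e M = sym (modN-cong (-ᶻ (+ M -ᶻ + (n + e))) (-ᶻ (modN n (-ᶻ + e) +ᶻ + M)) (+ 1 -ᶻ Q) (begin
    -ᶻ (+ M -ᶻ + (n + e))
      ≡⟨ unfold (+ M) (+ n) (+ e) Q ⟩
    -ᶻ ((-ᶻ + e -ᶻ Q *ᶻ + n) +ᶻ + M) +ᶻ (+ 1 -ᶻ Q) *ᶻ + n
      ≡⟨ cong (λ r → -ᶻ (r +ᶻ + M) +ᶻ (+ 1 -ᶻ Q) *ᶻ + n) first ⟨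
    -ᶻ (modN n (-ᶻ + e) +ᶻ + M) +ᶻ (+ 1 -ᶻ Q) *ᶻ + n
      ∎))
    where
    open ≡-Reasoning
    Q : ℤ
    Q = (-ᶻ + e) /ℕ n
    first : modN n (-ᶻ + e) ≡ -ᶻ + e -ᶻ Q *ᶻ + n
    first = modN-rem (-ᶻ + e)
    unfold : ∀ M N E Q → -ᶻ (M -ᶻ (N +ᶻ E)) ≡ -ᶻ ((-ᶻ E -ᶻ Q *ᶻ N) +ᶻ M) +ᶻ (+ 1 -ᶻ Q) *ᶻ N
    unfold = ℤSolver.solve-∀

sumF≡∑ℤ : ∀ N F → sumF {N} (λ i → F (toℕ i)) ≡ ∑ℤ N F
sumF≡∑ℤ zero    F = refl
sumF≡∑ℤ (suc N) F = trans (cong (F 0 +ᶻ_) (sumF≡∑ℤ N (λ t → F (suc t)))) (sym (∑ℤ-head N F))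

-- The number j as an element of Fin (k + 1), truncated at k.
fin : (k : ℕ) → ℕ → Fin (suc k)
fin k       zero    = fzero
fin zero    (suc j) = fzero
fin (suc k) (suc j) = fsuc (fin k j)

toℕ-fin : ∀ k j → j ≤ k → toℕ (fin k j) ≡ j
toℕ-fin k       zero    _         = refl
toℕ-fin (suc k) (suc j) (s≤s j≤k) = cong suc (toℕ-fin k j j≤k)

sumF-cong : ∀ {k} {f g : Fin k → ℤ} → f ≗ g → sumF f ≡ sumF g
sumF-cong {zero}  f≗g = refl
sumF-cong {suc k} f≗g = cong₂ _+ᶻ_ (f≗g fzero) (sumF-cong (f≗g ∘ fsuc))

isVertex-resp : ∀ {n m u v} → u ≗ v → IsVertex n m u → IsVertex n m v
isVertex-resp {n} u≗v isV = record
  { endRange = λ i end → subst (λ z → (+ 0 ℤ.≤ z) × (z ℤ.< + n)) (u≗v i) (IsVertex.endRange isV i end)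
  ; midRange = λ i notEnd → subst UnitRange (u≗v i) (IsVertex.midRange isV i notEnd)
  ; sumZero  = subst ((+ n) ∣_) (sumF-cong u≗v) (IsVertex.sumZero isV)
  }

adjacent-resp : ∀ {n m u u' v v'} → u ≗ u' → v ≗ v' → Adjacent n m u v → Adjacent n m u' v'
adjacent-resp {n} {m} {u} {u'} {v} {v'} u≗u' v≗v' (i , unchanged , dir) =
  i , (λ j j≢i j≢1+i → trans (sym (u≗u' j)) (trans (unchanged j j≢i j≢1+i) (v≗v' j))) ,
  ⊎-map (×-map (transport _ (_+ᶻ + 1)) (transport _ (_-ᶻ + 1)))
        (×-map (transport _ (_-ᶻ + 1)) (transport _ (_+ᶻ + 1))) dir
  where
  transport : ∀ k (f : ℤ → ℤ) → CoordEq n m k (u k) (f (v k)) → CoordEq n m k (u' k) (f (v' k))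
  transport k f = subst₂ (λ a b → CoordEq n m k a (f b)) (u≗u' k) (v≗v' k)

walk-resp-start : ∀ {n m u w v k} → u ≗ w → Walk n m w v (suc k) → Walk n m u v (suc k)
walk-resp-start u≗w (step isV adj walk) =
  step (isVertex-resp (sym ∘ u≗w) isV) (adjacent-resp (sym ∘ u≗w) (λ _ → refl) adj) walk

module Heights (n₁ m : ℕ) where
  open Residues n₁ public

  coord : (ℕ → ℤ) → ℕ → ℤ
  coord s zero = modN n (s 0)
  coord s (suc j) with j ℕP.≟ m
  ... | yes _ = modN n (-ᶻ s m)
  ... | no  _ = s (suc j) -ᶻ s j

  vtx : (ℕ → ℤ) → Coords m
  vtx s i = coord s (toℕ i)

  Valid : (ℕ → ℤ) → Set
  Valid s = ∀ t → t < m → Step (s t) (s (suc t))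

  coord-end : ∀ s j → (j ≡ 0 ⊎ j ≡ suc m) → (+ 0 ℤ.≤ coord s j) × (coord s j ℤ.< + n)
  coord-end s zero    _ = modN-range (s 0)
  coord-end s (suc j) (inj₂ 1+j≡1+m) with j ℕP.≟ m
  ... | yes _   = modN-range (-ᶻ s m)
  ... | no  j≢m = ⊥-elim (j≢m (ℕP.suc-injective 1+j≡1+m))

  coord-mid : ∀ s → Valid s → ∀ j → j < suc (suc m) → ¬ (j ≡ 0 ⊎ j ≡ suc m) → UnitRange (coord s j)
  coord-mid s valid zero    _  notEnd = ⊥-elim (notEnd (inj₁ refl))
  coord-mid s valid (suc j) j< notEnd with j ℕP.≟ m
  ... | yes j≡m = ⊥-elim (notEnd (inj₂ (cong suc j≡m)))
  ... | no  j≢m = step-difference (valid j (ℕP.≤∧≢⇒< (ℕP.≤-pred (ℕP.≤-pred j<)) j≢m))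

  coord-telescope : ∀ s k → k ≤ m → ∑ℤ (suc k) (coord s) ≡ modN n (s 0) +ᶻ (s k -ᶻ s 0)
  coord-telescope s zero    _   = trans (ℤP.+-identityˡ _) (zeroDiff (modN n (s 0)) (s 0))
    where
    zeroDiff : ∀ a b → a ≡ a +ᶻ (b -ᶻ b)
    zeroDiff = ℤSolver.solve-∀
  coord-telescope s (suc k) k<m with k ℕP.≟ m
  ... | yes k≡m = ⊥-elim (ℕP.<-irrefl k≡m k<m)
  ... | no  _   = trans (cong (_+ᶻ (s (suc k) -ᶻ s k)) (coord-telescope s k (ℕP.<⇒≤ k<m)))
                        (chain (modN n (s 0)) (s 0) (s k) (s (suc k)))
    where
    chain : ∀ a b c d → (a +ᶻ (c -ᶻ b)) +ᶻ (d -ᶻ c) ≡ a +ᶻ (d -ᶻ b)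
    chain = ℤSolver.solve-∀

  coord-sum : ∀ s → ∑ℤ (suc (suc m)) (coord s) ≡ (-ᶻ ((s 0 /ℕ n) +ᶻ ((-ᶻ s m) /ℕ n))) *ᶻ + n
  coord-sum s with m ℕP.≟ m
  ... | no m≢m = ⊥-elim (m≢m refl)
  ... | yes _  = begin
    ∑ℤ (suc m) (coord s) +ᶻ modN n (-ᶻ s m)
      ≡⟨ cong₂ _+ᶻ_ (coord-telescope s m ℕP.≤-refl) (modN-rem (-ᶻ s m)) ⟩
    (modN n (s 0) +ᶻ (s m -ᶻ s 0)) +ᶻ (-ᶻ s m -ᶻ b *ᶻ + n)
      ≡⟨ cong (λ r → (r +ᶻ (s m -ᶻ s 0)) +ᶻ (-ᶻ s m -ᶻ b *ᶻ + n)) (modN-rem (s 0)) ⟩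
    ((s 0 -ᶻ a *ᶻ + n) +ᶻ (s m -ᶻ s 0)) +ᶻ (-ᶻ s m -ᶻ b *ᶻ + n)
      ≡⟨ collapse (s 0) (s m) a b (+ n) ⟩
    (-ᶻ (a +ᶻ b)) *ᶻ + n
      ∎
    where
    open ≡-Reasoning
    a b : ℤ
    a = s 0 /ℕ n
    b = (-ᶻ s m) /ℕ n
    collapse : ∀ x y a b N → ((x -ᶻ a *ᶻ N) +ᶻ (y -ᶻ x)) +ᶻ (-ᶻ y -ᶻ b *ᶻ N) ≡ (-ᶻ (a +ᶻ b)) *ᶻ N
    collapse = ℤSolver.solve-∀

  vtx-isVertex : ∀ s → Valid s → IsVertex n m (vtx s)
  vtx-isVertex s valid = record
    { endRange = λ i end → coord-end s (toℕ i) end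
    ; midRange = λ i notEnd → coord-mid s valid (toℕ i) (FP.toℕ<n i) notEnd
    ; sumZero  = multiple⇒∣ _ (-ᶻ ((s 0 /ℕ n) +ᶻ ((-ᶻ s m) /ℕ n)))
                   (trans (sumF≡∑ℤ (suc (suc m)) (coord s)) (coord-sum s))
    }

  CoordEqℕ : ℕ → ℤ → ℤ → Set
  CoordEqℕ k a b = ((k ≡ 0 ⊎ k ≡ suc m) → (+ n) ∣ (a -ᶻ b)) × (¬ (k ≡ 0 ⊎ k ≡ suc m) → a ≡ b)

  module SingleChange (s s' : ℕ → ℤ) (p : ℕ) (p≤m : p ≤ m) (agree : ∀ t → t ≢ p → s t ≡ s' t) where

    coord-away : ∀ k → k ≢ p → k ≢ suc p → coord s k ≡ coord s' k
    coord-away zero    k≢p _ = cong (modN n) (agree 0 k≢p)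
    coord-away (suc j) k≢p k≢1+p with j ℕP.≟ m
    ... | yes refl = cong (λ z → modN n (-ᶻ z)) (agree j (λ j≡p → k≢1+p (cong suc j≡p)))
    ... | no  _    = cong₂ _-ᶻ_ (agree (suc j) k≢p) (agree j (λ j≡p → k≢1+p (cong suc j≡p)))

    -- (k is p; taking it as an argument lets us analyse its shape.)
    coord-at : ∀ d k → k ≡ p → s p ≡ s' p +ᶻ d → CoordEqℕ k (coord s k) (coord s' k +ᶻ d)
    coord-at d zero    refl sp = (λ _ → modN-shift-∣ (s 0) (s' 0) d sp) , (λ notEnd → ⊥-elim (notEnd (inj₁ refl)))
    coord-at d (suc q) refl sp with q ℕP.≟ m
    ... | yes refl = ⊥-elim (ℕP.<-irrefl refl p≤m)
    ... | no  q≢m  = (λ { (inj₁ ()) ; (inj₂ 1+q≡1+m) → ⊥-elim (q≢m (ℕP.suc-injective 1+q≡1+m)) })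
                   , (λ _ → trans (cong₂ _-ᶻ_ sp (agree q (ℕP.1+n≢n ∘ sym))) (shift (s' (suc q)) (s' q) d))
      where
      shift : ∀ a b d → (a +ᶻ d) -ᶻ b ≡ (a -ᶻ b) +ᶻ d
      shift = ℤSolver.solve-∀

    coord-after : ∀ d k → k ≡ suc p → s p ≡ s' p +ᶻ d → CoordEqℕ k (coord s k) (coord s' k -ᶻ d)
    coord-after d .(suc p) refl sp with p ℕP.≟ m
    ... | yes refl = (λ _ → modN-shift-∣ (-ᶻ s p) (-ᶻ s' p) (-ᶻ d) (trans (cong -ᶻ_ sp) (ℤP.neg-distrib-+ (s' p) d)))
                   , (λ notEnd → ⊥-elim (notEnd (inj₂ refl)))
    ... | no  p≢m  = (λ { (inj₁ ()) ; (inj₂ 1+p≡1+m) → ⊥-elim (p≢m (ℕP.suc-injective 1+p≡1+m)) })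
                   , (λ _ → trans (cong₂ _-ᶻ_ (agree (suc p) ℕP.1+n≢n) sp) (shift (s' (suc p)) (s' p) d))
      where
      shift : ∀ a b d → a -ᶻ (b +ᶻ d) ≡ (a -ᶻ b) -ᶻ d
      shift = ℤSolver.solve-∀

    edge : Fin (suc m)
    edge = fin m p

    toℕ-edge : toℕ (inject₁ edge) ≡ p
    toℕ-edge = trans (FP.toℕ-inject₁ edge) (toℕ-fin m p p≤m)

    toℕ-edge+1 : toℕ (fsuc edge) ≡ suc p
    toℕ-edge+1 = cong suc (toℕ-fin m p p≤m)

    unchanged : ∀ j → toℕ j ≢ toℕ (inject₁ edge) → toℕ j ≢ toℕ (fsuc edge) → vtx s j ≡ vtx s' j
    unchanged j j≢p j≢1+p =
      coord-away (toℕ j) (λ e → j≢p (trans e (sym toℕ-edge))) (λ e → j≢1+p (trans e (sym toℕ-edge+1)))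

    adjacent : (s p ≡ s' p +ᶻ + 1) ⊎ (s p ≡ s' p +ᶻ ℤ.-1ℤ) → Adjacent n m (vtx s) (vtx s')
    adjacent (inj₁ sp) = edge , unchanged , inj₁ (coord-at (+ 1) _ toℕ-edge sp , coord-after (+ 1) _ toℕ-edge+1 sp)
    adjacent (inj₂ sp) = edge , unchanged , inj₂ (coord-at ℤ.-1ℤ _ toℕ-edge sp , coord-after ℤ.-1ℤ _ toℕ-edge+1 sp)

-- Upper bound: greedy descent to the origin.

module Descent (n₁ m : ℕ) where
  open Heights n₁ m

  -- The total height Σ_{t ≤ m} |s_t|, which the descent decreases by one per edge.
  height : (ℕ → ℤ) → ℕ
  height s = ∑ℕ (suc m) (λ t → ℤ.∣ s t ∣)

  valid-update : ∀ s p x → Valid s → (p < m → Step x (s (suc p))) →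
                 (∀ q → suc q ≡ p → q < m → Step (s q) x) → Valid (update s p x)
  valid-update s p x valid right left t t<m with ≡-or-≢ t p
  ... | inj₁ refl = subst₂ Step (sym (update-at s t x)) (sym (update-away s t x (suc t) ℕP.1+n≢n)) (right t<m)
  ... | inj₂ t≢p with ≡-or-≢ (suc t) p
  ...   | inj₁ 1+t≡p = subst₂ Step (sym (update-away s p x t t≢p))
                         (sym (trans (cong (update s p x) 1+t≡p) (update-at s p x))) (left t 1+t≡p t<m)
  ...   | inj₂ 1+t≢p = subst₂ Step (sym (update-away s p x t t≢p))
                         (sym (update-away s p x (suc t) 1+t≢p)) (valid t t<m)

  height-update : ∀ s p x → p ≤ m → ℤ.∣ s p ∣ ≡ suc ℤ.∣ x ∣ → height s ≡ suc (height (update s p x))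
  height-update s p x p≤m abs = ∑ℕ-raise (suc m) p (s≤s p≤m)
    (λ t _ t≢p → cong ℤ.∣_∣ (sym (update-away s p x t t≢p)))
    (trans abs (cong (suc ∘ ℤ.∣_∣) (sym (update-at s p x))))

  move : ∀ s k p x → p ≤ m → Valid s → height s ≡ suc k → ℤ.∣ s p ∣ ≡ suc ℤ.∣ x ∣ →
         (p < m → Step x (s (suc p))) → (∀ q → suc q ≡ p → q < m → Step (s q) x) →
         (s p ≡ x +ᶻ + 1) ⊎ (s p ≡ x +ᶻ ℤ.-1ℤ) →
         ∃[ s' ] (Valid s' × height s' ≡ k × Adjacent n m (vtx s) (vtx s'))
  move s k p x p≤m valid h≡ abs right left dir =
    s' , valid-update s p x valid right left ,
    ℕP.suc-injective (trans (sym (height-update s p x p≤m abs)) h≡) ,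
    SingleChange.adjacent s s' p p≤m (λ t t≢p → sym (update-away s p x t t≢p))
      (⊎-map (λ e → trans e (cong (_+ᶻ + 1) (sym (update-at s p x))))
             (λ e → trans e (cong (_+ᶻ ℤ.-1ℤ) (sym (update-at s p x)))) dir)
    where
    s' : ℕ → ℤ
    s' = update s p x

  descend-step : ∀ s k → Valid s → height s ≡ suc k →
                 ∃[ s' ] (Valid s' × height s' ≡ k × Adjacent n m (vtx s) (vtx s'))
  descend-step s k valid h≡ with argmax (λ t → ℤ.∣ s t ∣) m
  ... | p , p≤m , isMax with sign-cases (s p)
  ...   | inj₁ positive = move s k p (s p -ᶻ + 1) p≤m valid h≡ (abs-toward0-pos (s p) positive)
            (λ p<m → step-sym (step-lower (step-sym (valid p p<m)) (below (suc p) p<m)))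
            (λ { q refl q<m → step-lower (valid q q<m) (below q (ℕP.<⇒≤ q<m)) })
            (inj₁ (back (s p)))
    where
    below : ∀ t → t ≤ m → s t ℤ.≤ s p
    below t t≤m = abs-dominates-pos (s t) (s p) (isMax t t≤m) positive
    back : ∀ y → y ≡ (y -ᶻ + 1) +ᶻ + 1
    back = ℤSolver.solve-∀
  ...   | inj₂ (inj₂ negative) = move s k p (s p +ᶻ + 1) p≤m valid h≡ (abs-toward0-neg (s p) negative)
            (λ p<m → step-sym (step-raise (step-sym (valid p p<m)) (above (suc p) p<m)))
            (λ { q refl q<m → step-raise (valid q q<m) (above q (ℕP.<⇒≤ q<m)) })
            (inj₂ (back (s p)))
    where
    above : ∀ t → t ≤ m → s p ℤ.≤ s t
    above t t≤m = abs-dominates-neg (s t) (s p) (isMax t t≤m) negative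
    back : ∀ y → y ≡ (y +ᶻ + 1) +ᶻ ℤ.-1ℤ
    back = ℤSolver.solve-∀
  ...   | inj₂ (inj₁ sp≡0) = ⊥-elim (ℕP.0≢1+n (trans (sym allZero) h≡))
    where
    allZero : height s ≡ 0
    allZero = ∑ℕ-zeros (suc m) (λ t t≤m →
      ℕP.n≤0⇒n≡0 (subst (ℤ.∣ s t ∣ ≤_) (cong ℤ.∣_∣ sp≡0) (isMax t (ℕP.≤-pred t≤m))))

  vtx-zero : ∀ s → (∀ t → t ≤ m → s t ≡ + 0) → vtx s ≗ zeroV m
  vtx-zero s zeros i = coord-zero (toℕ i) (FP.toℕ<n i)
    where
    coord-zero : ∀ j → j < suc (suc m) → coord s j ≡ + 0
    coord-zero zero    _ rewrite zeros 0 z≤n = refl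
    coord-zero (suc j) j< with j ℕP.≟ m
    ... | yes refl rewrite zeros j ℕP.≤-refl = refl
    ... | no  j≢m  rewrite zeros j (ℕP.≤-pred (ℕP.≤-pred j<))
                         | zeros (suc j) (ℕP.≤∧≢⇒< (ℕP.≤-pred (ℕP.≤-pred j<)) j≢m) = refl

  descend : ∀ k s → Valid s → height s ≡ suc k → Walk n m (vtx s) (zeroV m) (suc k)
  descend k s valid h≡ with descend-step s k valid h≡
  descend zero    s valid h≡ | s' , valid' , h'≡0 , adj =
    step (vtx-isVertex s valid) (adjacent-resp (λ _ → refl) atOrigin adj)
         (here (isVertex-resp atOrigin (vtx-isVertex s' valid')))
    where
    atOrigin : vtx s' ≗ zeroV m
    atOrigin = vtx-zero s' (λ t t≤m → ℤP.∣i∣≡0⇒i≡0 (∑ℕ≡0⇒zeros (suc m) h'≡0 t (s≤s t≤m)))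
  descend (suc k) s valid h≡ | s' , valid' , h'≡ , adj =
    step (vtx-isVertex s valid) adj (descend k s' valid' h'≡)

-- Lower bound: a potential that changes by at most one along each edge.

module Potential (n₁ m : ℕ) where
  open Heights n₁ m

  at : Coords m → ℕ → ℤ
  at u j = u (fin (suc m) j)

  prefix : Coords m → ℕ → ℤ
  prefix u t = ∑ℤ (suc t) (at u)

  potential : ℤ → Coords m → ℕ
  potential J u = ∑ℕ (suc m) (λ t → ℤ.∣ prefix u t -ᶻ J *ᶻ + n ∣)

  record EdgeShape (u v : Coords m) : Set where
    field
      p       : ℕ
      p≤m     : p ≤ m
      c ε     : ℤ
      ∣ε∣≡1   : ℤ.∣ ε ∣ ≡ 1
      noWrap  : p ≢ 0 → c ≡ + 0
      away    : ∀ j → j ≤ suc m → j ≢ p → j ≢ suc p → at u j ≡ at v j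
      atP     : at u p ≡ at v p +ᶻ ε +ᶻ c *ᶻ + n
      atNext  : suc p ≤ m → at u (suc p) ≡ at v (suc p) -ᶻ ε

  edgeShape : ∀ {u v} → Adjacent n m u v → EdgeShape u v
  edgeShape {u} {v} (i , unchanged , dir) =
    [ (λ (atP , atNext) → build (+ 1)   refl atP (λ p<m → proj₂ atNext (next-mid p<m)))
    , (λ (atP , atNext) → build ℤ.-1ℤ refl atP (λ p<m → proj₂ atNext (next-mid p<m))) ]′ dir
    where
    p : ℕ
    p = toℕ i
    p≤m : p ≤ m
    p≤m = ℕP.≤-pred (FP.toℕ<n i)
    fin-p : fin (suc m) p ≡ inject₁ i
    fin-p = FP.toℕ-injective (trans (toℕ-fin (suc m) p (ℕP.m≤n⇒m≤1+n p≤m)) (sym (FP.toℕ-inject₁ i)))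
    fin-p+1 : fin (suc m) (suc p) ≡ fsuc i
    fin-p+1 = FP.toℕ-injective (toℕ-fin (suc m) (suc p) (s≤s p≤m))
    away : ∀ j → j ≤ suc m → j ≢ p → j ≢ suc p → at u j ≡ at v j
    away j j≤ j≢p j≢p+1 = unchanged (fin (suc m) j)
      (λ e → j≢p (trans (sym (toℕ-fin (suc m) j j≤)) (trans e (FP.toℕ-inject₁ i))))
      (λ e → j≢p+1 (trans (sym (toℕ-fin (suc m) j j≤)) e))
    p-end : p ≡ 0 → IsEnd m (inject₁ i)
    p-end p≡0 = inj₁ (trans (FP.toℕ-inject₁ i) p≡0)
    p-mid : p ≢ 0 → ¬ IsEnd m (inject₁ i)
    p-mid p≢0 (inj₁ e) = p≢0 (trans (sym (FP.toℕ-inject₁ i)) e)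
    p-mid p≢0 (inj₂ e) = ℕP.<-irrefl (trans (sym (FP.toℕ-inject₁ i)) e) (s≤s p≤m)
    next-mid : suc p ≤ m → ¬ IsEnd m (fsuc i)
    next-mid p<m (inj₁ ())
    next-mid p<m (inj₂ e) = ℕP.<-irrefl (ℕP.suc-injective e) p<m
    wrap : ∀ ε → CoordEq n m (inject₁ i) (u (inject₁ i)) (v (inject₁ i) +ᶻ ε) →
           ∃[ c ] ((p ≢ 0 → c ≡ + 0) × (u (inject₁ i) ≡ v (inject₁ i) +ᶻ ε +ᶻ c *ᶻ + n))
    wrap ε (atEnd , atMid) with p ℕP.≟ 0
    ... | yes p≡0 = let (c , eq) = ∣⇒congruent _ _ (atEnd (p-end p≡0))
                    in c , (λ p≢0 → ⊥-elim (p≢0 p≡0)) , eq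
    ... | no  p≢0 = + 0 , (λ _ → refl) , trans (atMid (p-mid p≢0)) (sym (ℤP.+-identityʳ _))
    build : ∀ ε → ℤ.∣ ε ∣ ≡ 1 → CoordEq n m (inject₁ i) (u (inject₁ i)) (v (inject₁ i) +ᶻ ε) →
            (suc p ≤ m → u (fsuc i) ≡ v (fsuc i) -ᶻ ε) → EdgeShape u v
    build ε ∣ε∣≡1 atP atNext = record
      { p = p ; p≤m = p≤m ; c = c ; ε = ε ; ∣ε∣≡1 = ∣ε∣≡1 ; noWrap = proj₁ (proj₂ (wrap ε atP))
      ; away = away
      ; atP = trans (cong u fin-p)
                (trans (proj₂ (proj₂ (wrap ε atP))) (cong (λ z → z +ᶻ ε +ᶻ c *ᶻ + n) (cong v (sym fin-p))))
      ; atNext = λ p<m → trans (cong u fin-p+1) (trans (atNext p<m) (cong (_-ᶻ ε) (cong v (sym fin-p+1)))) }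
      where
      c : ℤ
      c = proj₁ (wrap ε atP)

  module PrefixChange (u v : Coords m) (p : ℕ) (p≤m : p ≤ m) (c ε : ℤ)
                      (away : ∀ j → j ≤ suc m → j ≢ p → j ≢ suc p → at u j ≡ at v j)
                      (atP : at u p ≡ at v p +ᶻ ε +ᶻ c *ᶻ + n)
                      (atNext : suc p ≤ m → at u (suc p) ≡ at v (suc p) -ᶻ ε) where

    before : ∀ t → t < p → prefix u t ≡ prefix v t
    before zero    0<p   = cong (+ 0 +ᶻ_) (away 0 z≤n (ℕP.<⇒≢ 0<p) (λ ()))
    before (suc t) 1+t<p = cong₂ _+ᶻ_ (before t (ℕP.<-trans (ℕP.n<1+n t) 1+t<p))
      (away (suc t) (ℕP.≤-trans (ℕP.<⇒≤ 1+t<p) (ℕP.m≤n⇒m≤1+n p≤m)) (ℕP.<⇒≢ 1+t<p)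
            (λ e → ℕP.<⇒≢ (ℕP.<-trans (ℕP.n<1+n t) 1+t<p) (ℕP.suc-injective e)))

    -- (k is p; taking it as an argument lets us analyse its shape.)
    at-p : ∀ k → k ≡ p → prefix u k ≡ prefix v k +ᶻ ε +ᶻ c *ᶻ + n
    at-p zero    refl = trans (cong (+ 0 +ᶻ_) atP) (regroup (+ 0) (at v 0) ε (c *ᶻ + n))
      where
      regroup : ∀ a b x y → a +ᶻ (b +ᶻ x +ᶻ y) ≡ (a +ᶻ b) +ᶻ x +ᶻ y
      regroup = ℤSolver.solve-∀
    at-p (suc q) refl = trans (cong₂ _+ᶻ_ (before q (ℕP.n<1+n q)) atP)
                              (regroup (prefix v q) (at v (suc q)) ε (c *ᶻ + n))
      where
      regroup : ∀ a b x y → a +ᶻ (b +ᶻ x +ᶻ y) ≡ (a +ᶻ b) +ᶻ x +ᶻ y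
      regroup = ℤSolver.solve-∀

    after : ∀ t → t ≤ m → p < t → prefix u t ≡ prefix v t +ᶻ c *ᶻ + n
    after (suc q) 1+q≤m p<1+q with ≡-or-≢ q p
    ... | inj₁ refl = trans (cong₂ _+ᶻ_ (at-p q refl) (atNext 1+q≤m))
                            (cancelε (prefix v q) ε (c *ᶻ + n) (at v (suc q)))
      where
      cancelε : ∀ a e x b → (a +ᶻ e +ᶻ x) +ᶻ (b -ᶻ e) ≡ (a +ᶻ b) +ᶻ x
      cancelε = ℤSolver.solve-∀
    ... | inj₂ q≢p = trans (cong₂ _+ᶻ_ (after q (ℕP.<⇒≤ 1+q≤m) p<q) nextTerm)
                           (swap (prefix v q) (c *ᶻ + n) (at v (suc q)))
      where
      p<q : p < q
      p<q = ℕP.≤∧≢⇒< (ℕP.≤-pred p<1+q) (q≢p ∘ sym)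
      nextTerm : at u (suc q) ≡ at v (suc q)
      nextTerm = away (suc q) (ℕP.m≤n⇒m≤1+n 1+q≤m) (ℕP.<⇒≢ p<1+q ∘ sym) (q≢p ∘ ℕP.suc-injective)
      swap : ∀ a x b → (a +ᶻ x) +ᶻ b ≡ (a +ᶻ b) +ᶻ x
      swap = ℤSolver.solve-∀

  potential-step : ∀ {u v} (E : EdgeShape u v) J → potential (J +ᶻ EdgeShape.c E) u ≤ suc (potential J v)
  potential-step {u} {v} E J = ∑ℕ-raise-≤ (suc m) p (s≤s p≤m) unchangedTerm changedTerm
    where
    open EdgeShape E
    open PrefixChange u v p p≤m c ε away atP atNext
    shiftJ : ∀ a J c N → (a +ᶻ c *ᶻ N) -ᶻ (J +ᶻ c) *ᶻ N ≡ a -ᶻ J *ᶻ N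
    shiftJ = ℤSolver.solve-∀
    unchangedTerm : ∀ t → t < suc m → t ≢ p →
                    ℤ.∣ prefix u t -ᶻ (J +ᶻ c) *ᶻ + n ∣ ≡ ℤ.∣ prefix v t -ᶻ J *ᶻ + n ∣
    unchangedTerm t t<1+m t≢p with ℕP.<-cmp t p
    ... | tri< t<p _ _ = cong ℤ.∣_∣ (begin
          prefix u t -ᶻ (J +ᶻ c) *ᶻ + n        ≡⟨ cong₂ (λ a b → a -ᶻ (J +ᶻ b) *ᶻ + n) (before t t<p) (noWrap p≢0) ⟩
          prefix v t -ᶻ (J +ᶻ + 0) *ᶻ + n      ≡⟨ cong (λ z → prefix v t -ᶻ z *ᶻ + n) (ℤP.+-identityʳ J) ⟩
          prefix v t -ᶻ J *ᶻ + n               ∎)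
      where
      open ≡-Reasoning
      p≢0 : p ≢ 0
      p≢0 = ℕP.n>0⇒n≢0 (ℕP.≤-trans (s≤s z≤n) t<p)
    ... | tri≈ _ t≡p _ = ⊥-elim (t≢p t≡p)
    ... | tri> _ _ p<t = cong ℤ.∣_∣ (trans (cong (_-ᶻ (J +ᶻ c) *ᶻ + n) (after t (ℕP.≤-pred t<1+m) p<t))
                                          (shiftJ (prefix v t) J c (+ n)))
    changedTerm : ℤ.∣ prefix u p -ᶻ (J +ᶻ c) *ᶻ + n ∣ ≤ suc ℤ.∣ prefix v p -ᶻ J *ᶻ + n ∣
    changedTerm = begin
      ℤ.∣ prefix u p -ᶻ (J +ᶻ c) *ᶻ + n ∣ ≡⟨ cong ℤ.∣_∣ (trans (cong (_-ᶻ (J +ᶻ c) *ᶻ + n) (at-p p refl)) shifted) ⟩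
      ℤ.∣ A +ᶻ ε ∣                         ≤⟨ ℤP.∣i+j∣≤∣i∣+∣j∣ A ε ⟩
      ℤ.∣ A ∣ + ℤ.∣ ε ∣                    ≡⟨ cong (ℕ._+_ ℤ.∣ A ∣) ∣ε∣≡1 ⟩
      ℤ.∣ A ∣ + 1                          ≡⟨ ℕP.+-comm _ 1 ⟩
      suc ℤ.∣ A ∣                          ∎
      where
      open ℕP.≤-Reasoning
      A : ℤ
      A = prefix v p -ᶻ J *ᶻ + n
      shiftε : ∀ a e c J N → (a +ᶻ e +ᶻ c *ᶻ N) -ᶻ (J +ᶻ c) *ᶻ N ≡ (a -ᶻ J *ᶻ N) +ᶻ e
      shiftε = ℤSolver.solve-∀
      shifted : prefix v p +ᶻ ε +ᶻ c *ᶻ + n -ᶻ (J +ᶻ c) *ᶻ + n ≡ (prefix v p -ᶻ J *ᶻ + n) +ᶻ ε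
      shifted = shiftε (prefix v p) ε c J (+ n)

  -- Every walk from u to the origin is at least as long as some potential of u,
  -- since all potentials of the origin with J = 0 vanish.
  walk-bound : ∀ {u j} → Walk n m u (zeroV m) j → ∃[ J ] potential J u ≤ j
  walk-bound (here _) =
    + 0 , ℕP.≤-reflexive (∑ℕ-zeros (suc m) (λ t _ → cong ℤ.∣_∣ (trans (ℤP.+-identityʳ _) (zeros (suc t)))))
    where
    zeros : ∀ N → ∑ℤ N (λ _ → + 0) ≡ + 0
    zeros zero    = refl
    zeros (suc N) = trans (ℤP.+-identityʳ _) (zeros N)
  walk-bound (step _ adj walk) with walk-bound walk
  ... | J , bound = J +ᶻ EdgeShape.c (edgeShape adj) , ℕP.≤-trans (potential-step (edgeShape adj) J) (s≤s bound)

  potential-resp : ∀ J {u w} → u ≗ w → potential J u ≡ potential J w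
  potential-resp J u≗w = ∑ℕ-cong (suc m) (λ t _ →
    cong (λ z → ℤ.∣ z -ᶻ J *ᶻ + n ∣) (∑ℤ-cong (suc t) (λ j _ → u≗w (fin (suc m) j))))

  potential-vtx : ∀ s J → potential J (vtx s) ≡ ∑ℕ (suc m) (λ t → ℤ.∣ s t -ᶻ (J +ᶻ (s 0 /ℕ n)) *ᶻ + n ∣)
  potential-vtx s J = ∑ℕ-cong (suc m) λ t t≤m → cong ℤ.∣_∣ (begin
    prefix (vtx s) t -ᶻ J *ᶻ + n
      ≡⟨ cong (_-ᶻ J *ᶻ + n) (∑ℤ-cong (suc t) (entries t t≤m)) ⟩
    ∑ℤ (suc t) (coord s) -ᶻ J *ᶻ + n
      ≡⟨ cong (_-ᶻ J *ᶻ + n) (coord-telescope s t (ℕP.≤-pred t≤m)) ⟩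
    (modN n (s 0) +ᶻ (s t -ᶻ s 0)) -ᶻ J *ᶻ + n
      ≡⟨ cong (λ r → (r +ᶻ (s t -ᶻ s 0)) -ᶻ J *ᶻ + n) (modN-rem (s 0)) ⟩
    ((s 0 -ᶻ q *ᶻ + n) +ᶻ (s t -ᶻ s 0)) -ᶻ J *ᶻ + n
      ≡⟨ collect (s 0) (s t) q J (+ n) ⟩
    s t -ᶻ (J +ᶻ q) *ᶻ + n
      ∎)
    where
    open ≡-Reasoning
    q : ℤ
    q = s 0 /ℕ n
    entries : ∀ t → t < suc m → ∀ j → j < suc t → at (vtx s) j ≡ coord s j
    entries t t≤m j j≤t = cong (coord s) (toℕ-fin (suc m) j
      (ℕP.≤-trans (ℕP.≤-pred j≤t) (ℕP.≤-trans (ℕP.≤-pred t≤m) (ℕP.n≤1+n m))))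
    collect : ∀ x y q J N → ((x -ᶻ q *ᶻ N) +ᶻ (y -ᶻ x)) -ᶻ J *ᶻ N ≡ y -ᶻ (J +ᶻ q) *ᶻ N
    collect = ℤSolver.solve-∀

  walk-bound-heights : ∀ s {u} → u ≗ vtx s → ∀ {j} → Walk n m u (zeroV m) j →
                       ∃[ J ] ∑ℕ (suc m) (λ t → ℤ.∣ s t -ᶻ J *ᶻ + n ∣) ≤ j
  walk-bound-heights s u≗s walk with walk-bound walk
  ... | J , bound = J +ᶻ (s 0 /ℕ n) ,
                    ℕP.≤-trans (ℕP.≤-reflexive (sym (trans (potential-resp J u≗s) (potential-vtx s J)))) bound

module Distance (n₁ m : ℕ) where
  open Heights n₁ m public
  open Descent n₁ m
  open Potential n₁ m

  shifted : (ℕ → ℕ) → ℕ → ℕ → ℤ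
  shifted σ B t = + σ t -ᶻ + B

  spread : (ℕ → ℕ) → ℕ → ℕ
  spread σ b = ∑ℕ (suc m) (λ t → ℕ.∣ σ t - b ∣)

  -- The centres B + J·n (J ∈ ℤ) all avoid the open interval (e, B) = (B − n, B),
  -- and negative centres are worse than 0.
  centres-bound : ∀ σ e K → (∀ b → b ≤ e → K ≤ spread σ b) → (∀ b → n + e ≤ b → K ≤ spread σ b) →
                  ∀ J → K ≤ ∑ℕ (suc m) (λ t → ℤ.∣ shifted σ (n + e) t -ᶻ J *ᶻ + n ∣)
  centres-bound σ e K low high J =
    subst (K ≤_) (∑ℕ-cong (suc m) (λ t _ → cong ℤ.∣_∣ (sym (regroup (+ σ t) (+ B) J (+ n)))))
          (aroundCentre (+ B +ᶻ J *ᶻ + n) refl)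
    where
    B : ℕ
    B = n + e
    regroup : ∀ x B J N → x -ᶻ B -ᶻ J *ᶻ N ≡ x -ᶻ (B +ᶻ J *ᶻ N)
    regroup = ℤSolver.solve-∀
    aroundCentre : ∀ T → T ≡ + B +ᶻ J *ᶻ + n → K ≤ ∑ℕ (suc m) (λ t → ℤ.∣ + σ t -ᶻ T ∣)
    aroundCentre (+ b) b≡ = subst (K ≤_) (sym (∑ℕ-cong (suc m) (λ t _ → ∣+a-+b∣ (σ t) b))) (avoid J b≡)
      where
      avoid : ∀ J → + b ≡ + B +ᶻ J *ᶻ + n → K ≤ spread σ b
      avoid (+ a)    b≡ = high b (subst (B ≤_) (sym b≡B+an) (ℕP.m≤m+n B (a * n)))
        where
        b≡B+an : b ≡ B + a * n
        b≡B+an = cong ℤ.∣_∣ (trans b≡ (cong (+ B +ᶻ_) (sym (ℤP.pos-* a n))))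
      avoid -[1+ a ] b≡ = low b (ℕP.+-cancelʳ-≤ n b e (subst (b + n ≤_) (trans B≡ (ℕP.+-comm n e))
                                                         (ℕP.+-monoʳ-≤ b (ℕP.m≤m+n n (a * n)))))
        where
        undo : ∀ y P N → y ≡ (y +ᶻ (-ᶻ P) *ᶻ N) +ᶻ P *ᶻ N
        undo = ℤSolver.solve-∀
        B≡ : b + suc a * n ≡ n + e
        B≡ = cong ℤ.∣_∣ (sym (trans (undo (+ B) (+ suc a) (+ n)) (cong (_+ᶻ + suc a *ᶻ + n) (sym b≡))))
    aroundCentre -[1+ x ] _ = ℕP.≤-trans (low 0 z≤n) (∑ℕ-mono (suc m) (λ t _ →
      ℕP.≤-trans (ℕP.≤-reflexive (ℕP.∣-∣-identityʳ (σ t))) (ℕP.m≤m+n (σ t) (suc x))))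

  distance : ∀ σ e K u → let s = shifted σ (n + e) in
             Valid s → u ≗ vtx s → spread σ (n + e) ≡ K → 1 ≤ K →
             (∀ b → b ≤ e → K ≤ spread σ b) → (∀ b → n + e ≤ b → K ≤ spread σ b) →
             Dist n m u (zeroV m) K
  distance σ e (suc k) u valid u≗s spread≡ _ low high =
    walk-resp-start u≗s (descend k s valid (trans height≡spread spread≡)) ,
    λ j walk → let (J , bound) = walk-bound-heights s u≗s walk
               in ℕP.≤-trans (centres-bound σ e (suc k) low high J) bound
    where
    s : ℕ → ℤ
    s = shifted σ (n + e)
    height≡spread : height s ≡ spread σ (n + e)
    height≡spread = ∑ℕ-cong (suc m) (λ t _ → ∣+a-+b∣ (σ t) (n + e))

  increment-level : ∀ σ B j → σ (suc j) ≡ σ j → shifted σ B (suc j) -ᶻ shifted σ B j ≡ + 0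
  increment-level σ B j level =
    trans (cong (λ z → (+ z -ᶻ + B) -ᶻ shifted σ B j) level) (ℤP.+-inverseʳ (shifted σ B j))

  increment-climb : ∀ σ B j → σ (suc j) ≡ suc (σ j) → shifted σ B (suc j) -ᶻ shifted σ B j ≡ + 1
  increment-climb σ B j climb = trans (cong (λ z → (+ z -ᶻ + B) -ᶻ shifted σ B j) climb) (oneUp (+ σ j) (+ B))
    where
    oneUp : ∀ x B → ((+ 1 +ᶻ x) -ᶻ B) -ᶻ (x -ᶻ B) ≡ + 1
    oneUp = ℤSolver.solve-∀

  shifted-step : ∀ σ B t → (σ (suc t) ≡ σ t) ⊎ (σ (suc t) ≡ suc (σ t)) →
                 Step (shifted σ B t) (shifted σ B (suc t))
  shifted-step σ B t (inj₁ level) = inj₁ (cong (λ z → + z -ᶻ + B) level)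
  shifted-step σ B t (inj₂ climb) = inj₂ (inj₁ (trans (cong (λ z → + z -ᶻ + B) climb) (oneUp (+ σ t) (+ B))))
    where
    oneUp : ∀ x B → (+ 1 +ᶻ x) -ᶻ B ≡ (x -ᶻ B) +ᶻ + 1
    oneUp = ℤSolver.solve-∀

  mkCoords≗vtx : ∀ a mid b s → a ≡ modN n (s 0) → b ≡ modN n (-ᶻ s m) →
                 (∀ j → j < m → mid (suc j) ≡ s (suc j) -ᶻ s j) → mkCoords m a mid b ≗ vtx s
  mkCoords≗vtx a mid b s first last middle i = byIndex (toℕ i) (FP.toℕ<n i)
    where
    byIndex : ∀ j → j < suc (suc m) → (if j ≡ᵇ 0 then a else (if j ≡ᵇ suc m then b else mid j)) ≡ coord s j
    byIndex zero    _ = first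
    byIndex (suc j) j< with j ℕP.≟ m
    ... | yes refl rewrite ≡ᵇ-refl j    = last
    ... | no  j≢m  rewrite ≡ᵇ-≢ j m j≢m = middle j (ℕP.≤∧≢⇒< (ℕP.≤-pred (ℕP.≤-pred j<)) j≢m)

  first-matches : ∀ σ e a → a ≡ modN n (-ᶻ + e) → σ 0 ≡ 0 → a ≡ modN n (shifted σ (n + e) 0)
  first-matches σ e a a≡ σ0≡0 =
    trans a≡ (trans (residue-start e) (cong (λ z → modN n (+ z -ᶻ + (n + e))) (sym σ0≡0)))

  last-matches : ∀ σ e a → a ≡ modN n (-ᶻ + e) → modN n (-ᶻ (a +ᶻ + σ m)) ≡ modN n (-ᶻ shifted σ (n + e) m)
  last-matches σ e a a≡ = trans (cong (λ z → modN n (-ᶻ (z +ᶻ + σ m))) a≡) (residue-end e (σ m))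

-- The distance of u⁰ when m = (n + e) + (e + r) with r ≤ 1: its heights are t − (n + e).
distance-u⁰ : ∀ n₁ m e r → r ≤ 1 → m ≡ (suc n₁ + e) + (e + r) → (m ∸ suc n₁) / 2 ≡ e →
              d⁰ (suc n₁) m (tri (suc n₁ + e) + tri (e + r))
distance-u⁰ n₁ m e r r≤1 m≡ halfDiff = distance σ e K (u⁰ n m) valid vertex spread≡ 1≤K low high
  where
  open Distance n₁ m
  σ : ℕ → ℕ
  σ t = t
  B K : ℕ
  B = n + e
  K = tri B + tri (e + r)
  valid : Valid (shifted σ B)
  valid t _ = shifted-step σ B t (inj₂ refl)
  first≡ : u0-first n m ≡ modN n (-ᶻ + e)
  first≡ = cong (λ z → modN n (-ᶻ + z)) halfDiff
  vertex : u⁰ n m ≗ vtx (shifted σ B)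
  vertex = mkCoords≗vtx (u0-first n m) (λ _ → + 1) (modN n (-ᶻ (u0-first n m +ᶻ + m))) (shifted σ B)
             (first-matches σ e (u0-first n m) first≡ refl) (last-matches σ e (u0-first n m) first≡)
             (λ j _ → sym (increment-climb σ B j refl))
  spread≡ : spread σ B ≡ K
  spread≡ = trans (cong (λ z → D (suc z) B) m≡) (D-closed B (e + r))
  1≤K : 1 ≤ K
  1≤K = ℕP.≤-trans (tri-positive (n₁ + e)) (ℕP.m≤m+n (tri B) (tri (e + r)))
  e+r≤B : e + r ≤ B
  e+r≤B = subst (e + r ≤_) (ℕP.+-comm e n) (ℕP.+-monoʳ-≤ e (ℕP.≤-trans r≤1 (s≤s z≤n)))
  low : ∀ b → b ≤ e → K ≤ spread σ b
  low b b≤e = subst (λ z → K ≤ D (suc z) b) (sym m≡)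
    (D-bound-left B (e + r) b (ℕP.≤-trans b≤e (ℕP.m≤n+m e n)) (ℕP.≤-trans b≤e (ℕP.m≤m+n e r)))
  high : ∀ b → B ≤ b → K ≤ spread σ b
  high b B≤b = subst (λ z → K ≤ D (suc z) b) (sym m≡)
    (D-bound-right B (e + r) b B≤b (ℕP.≤-trans e+r≤B B≤b))

-- The distance of u¹ when m = (n + e) + e + 1 and its zero coordinate sits at
-- position (m + 2)/2 = e + c + 1, where ⌈n/2⌉ ≤ c ≤ n: its heights are
-- plateau (e + c) t − (n + e).
distance-u¹ : ∀ n₁ m e c → c ≤ suc n₁ → suc n₁ ≤ c + c → m ≡ suc ((suc n₁ + e) + e) →
              (m ∸ suc n₁) / 2 ≡ e → (m + 2) / 2 ≡ suc (e + c) →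
              d¹ (suc n₁) m (tri (suc n₁ + e) + tri e + (suc n₁ ∸ c))
distance-u¹ n₁ m e c c≤n n≤2c m≡ halfDiff zeroAt = distance σ e K (u¹ n m) valid vertex spread≡ 1≤K low high
  where
  open Distance n₁ m
  h B K : ℕ
  h = e + c
  B = n + e
  K = tri B + tri e + (n ∸ c)
  σ : ℕ → ℕ
  σ = plateau h
  h≤B : h ≤ B
  h≤B = subst (h ≤_) (ℕP.+-comm e n) (ℕP.+-monoʳ-≤ e c≤n)
  h<m : h < m
  h<m = subst (h <_) (sym m≡) (s≤s (ℕP.≤-trans h≤B (ℕP.m≤m+n B e)))
  B∸h : B ∸ h ≡ n ∸ c
  B∸h = trans (cong (_∸ h) (ℕP.+-comm n e)) (ℕP.[m+n]∸[m+o]≡n∸o e n c)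
  valid : Valid (shifted σ B)
  valid t _ with ≡-or-≢ t h
  ... | inj₁ refl = shifted-step σ B t (inj₁ (plateau-repeat t))
  ... | inj₂ t≢h  = shifted-step σ B t (inj₂ (plateau-climb h t t≢h))
  mid : ℕ → ℤ
  mid i = if i ≡ᵇ ((m + 2) / 2) then + 0 else + 1
  middle : ∀ j → j < m → mid (suc j) ≡ shifted σ B (suc j) -ᶻ shifted σ B j
  middle j _ rewrite zeroAt with ≡-or-≢ j h
  ... | inj₁ refl rewrite ≡ᵇ-refl j    = sym (increment-level σ B j (plateau-repeat j))
  ... | inj₂ j≢h  rewrite ≡ᵇ-≢ j h j≢h = sym (increment-climb σ B j (plateau-climb h j j≢h))
  first≡ : u0-first n m ≡ modN n (-ᶻ + e)
  first≡ = cong (λ z → modN n (-ᶻ + z)) halfDiff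
  last≡ : modN n (-ᶻ (u0-first n m +ᶻ + (m ∸ 1))) ≡ modN n (-ᶻ shifted σ B m)
  last≡ = trans (cong (λ z → modN n (-ᶻ (u0-first n m +ᶻ + z))) (sym (plateau-> h m h<m)))
                (last-matches σ e (u0-first n m) first≡)
  vertex : u¹ n m ≗ vtx (shifted σ B)
  vertex = mkCoords≗vtx (u0-first n m) mid (modN n (-ᶻ (u0-first n m +ᶻ + (m ∸ 1)))) (shifted σ B)
             (first-matches σ e (u0-first n m) first≡ (plateau-≤ h 0 z≤n)) last≡ middle
  spread-about : ∀ b → spread σ b ≡ D (suc (B + e)) b + ℕ.∣ h - b ∣
  spread-about b = trans (plateau-D h m b h<m) (cong (λ z → D z b + ℕ.∣ h - b ∣) m≡)
  spread≡ : spread σ B ≡ K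
  spread≡ = trans (spread-about B) (cong₂ _+_ (D-closed B e) (trans (ℕP.m≤n⇒∣m-n∣≡n∸m h≤B) B∸h))
  1≤K : 1 ≤ K
  1≤K = ℕP.≤-trans (tri-positive (n₁ + e)) (ℕP.≤-trans (ℕP.m≤m+n (tri B) (tri e)) (ℕP.m≤m+n _ (n ∸ c)))
  low : ∀ b → b ≤ e → K ≤ spread σ b
  low b b≤e = subst (K ≤_) (sym (spread-about b))
    (ℕP.+-mono-≤ (D-bound-left B e b (ℕP.≤-trans b≤e (ℕP.m≤n+m e n)) b≤e) (begin
      n ∸ c          ≤⟨ ℕP.∸-monoˡ-≤ c n≤2c ⟩
      c + c ∸ c      ≡⟨ ℕP.m+n∸n≡m c c ⟩
      c              ≤⟨ ℕP.m≤n+m c (e ∸ b) ⟩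
      e ∸ b + c      ≡⟨ ℕP.+-∸-comm c b≤e ⟨
      h ∸ b          ≡⟨ ℕP.m≤n⇒∣n-m∣≡n∸m (ℕP.≤-trans b≤e (ℕP.m≤m+n e c)) ⟨
      ℕ.∣ h - b ∣    ∎))
    where open ℕP.≤-Reasoning
  high : ∀ b → B ≤ b → K ≤ spread σ b
  high b B≤b = subst (K ≤_) (sym (spread-about b))
    (ℕP.+-mono-≤ (D-bound-right B e b B≤b (ℕP.≤-trans (ℕP.m≤n+m e n) B≤b)) (begin
      n ∸ c          ≡⟨ B∸h ⟨
      B ∸ h          ≤⟨ ℕP.∸-monoˡ-≤ h B≤b ⟩
      b ∸ h          ≡⟨ ℕP.m≤n⇒∣m-n∣≡n∸m (ℕP.≤-trans h≤B B≤b) ⟨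
      ℕ.∣ h - b ∣    ∎))
    where open ℕP.≤-Reasoning

half : ∀ k r → r ≤ 1 → (k * 2 + r) / 2 ≡ k
half k zero          _        = trans (cong (_/ 2) (ℕP.+-identityʳ (k * 2))) (m*n/n≡m k 2)
half k (suc zero)    _        = trans (+-distrib-/ (k * 2) 1 (subst (λ z → z + 1 < 2) (sym (m*n%n≡0 k 2)) ℕP.≤-refl))
                                      (trans (cong (_+ 0) (m*n/n≡m k 2)) (ℕP.+-identityʳ k))
half k (suc (suc r)) (s≤s ())

half-up : ∀ k r → r ≤ 1 → (k * 2 + r + 1) / 2 ≡ k + r
half-up k zero          _        = trans (cong (λ z → (z + 1) / 2) (ℕP.+-identityʳ (k * 2)))
                                         (trans (half k 1 (s≤s z≤n)) (sym (ℕP.+-identityʳ k)))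
half-up k (suc zero)    _        = trans (cong (_/ 2) (twice k)) (half (k + 1) 0 z≤n)
  where
  twice : ∀ k → k * 2 + 1 + 1 ≡ (k + 1) * 2 + 0
  twice = ℕSolver.solve-∀
half-up k (suc (suc r)) (s≤s ())

parity : ∀ d → ∃[ e ] ∃[ r ] (r ≤ 1 × d ≡ e * 2 + r)
parity d = d / 2 , d % 2 , ℕP.≤-pred (m%n<n d 2) , trans (m≡m%n+[m/n]*n d 2) (ℕP.+-comm (d % 2) _)

half-bounds : ∀ n c ρ → ρ ≤ 1 → suc n ≡ c * 2 + ρ → c ≤ n × n ≤ c + c
half-bounds n c ρ ρ≤1 split = upper c (subst (c * 2 ≤_) (sym split) (ℕP.m≤m+n (c * 2) ρ)) , lower
  where
  upper : ∀ c → c * 2 ≤ suc n → c ≤ n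
  upper zero    _             = z≤n
  upper (suc c) (s≤s 2c+1≤n) = ℕP.≤-trans (s≤s (ℕP.m≤m*n c 2)) 2c+1≤n
  double : ∀ c → c * 2 + 1 ≡ suc (c + c)
  double = ℕSolver.solve-∀
  lower : n ≤ c + c
  lower = ℕP.≤-pred (subst (suc n ≤_) (double c)
                       (subst (_≤ c * 2 + 1) (sym split) (ℕP.+-monoʳ-≤ (c * 2) ρ≤1)))

C2≡tri : ∀ x → (x + 1) C 2 ≡ tri x
C2≡tri x = cong (_C 2) (ℕP.+-comm x 1)

half-difference : ∀ n e r → r ≤ 1 → (n + (e * 2 + r) ∸ n) / 2 ≡ e
half-difference n e r r≤1 = trans (cong (_/ 2) (ℕP.m+n∸m≡n n (e * 2 + r))) (half e r r≤1)

zero-position : ∀ n e c ρ → ρ ≤ 1 → suc n ≡ c * 2 + ρ → (n + (e * 2 + 1) + 2) / 2 ≡ suc (e + c)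
zero-position n e c ρ ρ≤1 split =
  trans (cong (_/ 2) (trans (plus2 n e) (trans (cong (_+ (e * 2 + 2)) split) (regroup c ρ e))))
        (half (suc (e + c)) ρ ρ≤1)
  where
  plus2 : ∀ n e → n + (e * 2 + 1) + 2 ≡ suc n + (e * 2 + 2)
  plus2 = ℕSolver.solve-∀
  regroup : ∀ c ρ e → c * 2 + ρ + (e * 2 + 2) ≡ suc (e + c) * 2 + ρ
  regroup = ℕSolver.solve-∀

-- The distance value in part (2): subtracting the zero position e + c + 1 from
-- tri (n + e + 1) + tri e, using tri (n + e + 1) = tri (n + e) + c + (n − c) + e + 1.
subtract-position : ∀ n e c → c ≤ n → tri (suc (n + e)) + tri e ∸ suc (e + c) ≡ tri (n + e) + tri e + (n ∸ c)
subtract-position n e c c≤n = begin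
  tri (suc (n + e)) + tri e ∸ suc (e + c)                   ≡⟨ cong (λ z → z + tri e ∸ suc (e + c)) (tri-suc (n + e)) ⟩
  tri (n + e) + suc (n + e) + tri e ∸ suc (e + c)           ≡⟨ cong (λ z → T + suc (z + e) + tri e ∸ suc (e + c)) split ⟨
  tri (n + e) + suc (c + (n ∸ c) + e) + tri e ∸ suc (e + c) ≡⟨ cong (_∸ suc (e + c)) (regroup T (tri e) c (n ∸ c) e) ⟩
  tri (n + e) + tri e + (n ∸ c) + suc (e + c) ∸ suc (e + c) ≡⟨ ℕP.m+n∸n≡m _ (suc (e + c)) ⟩
  tri (n + e) + tri e + (n ∸ c)                             ∎
  where
  open ≡-Reasoning
  T : ℕ
  T = tri (n + e)
  split : c + (n ∸ c) ≡ n
  split = ℕP.m+[n∸m]≡n c≤n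
  regroup : ∀ T E c X e → T + suc (c + X + e) + E ≡ T + E + X + suc (e + c)
  regroup = ℕSolver.solve-∀

-- ... and the subtraction does not truncate.
position-bound : ∀ n e c → c ≤ n → suc (e + c) ≤ tri (suc (n + e)) + tri e
position-bound n e c c≤n = begin
  suc (e + c)                      ≤⟨ s≤s (subst (e + c ≤_) (ℕP.+-comm e n) (ℕP.+-monoʳ-≤ e c≤n)) ⟩
  suc (n + e)                      ≤⟨ ℕP.m≤n+m (suc (n + e)) (tri (n + e)) ⟩
  tri (n + e) + suc (n + e)        ≡⟨ tri-suc (n + e) ⟨
  tri (suc (n + e))                ≤⟨ ℕP.m≤m+n _ (tri e) ⟩
  tri (suc (n + e)) + tri e        ∎
  where open ℕP.≤-Reasoning

claim⁰ : ∀ n₁ e r → r ≤ 1 → let n = suc n₁ ; m = n + (e * 2 + r) in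
         d⁰ n m ((((m + n) / 2) + 1) C 2 + ((((m ∸ n) + 1) / 2) + 1) C 2)
claim⁰ n₁ e r r≤1 =
  subst (d⁰ n m) (sym value) (distance-u⁰ n₁ m e r r≤1 (shape n e r) (half-difference n e r r≤1))
  where
  n m : ℕ
  n = suc n₁
  m = n + (e * 2 + r)
  shape : ∀ n e r → n + (e * 2 + r) ≡ (n + e) + (e + r)
  shape = ℕSolver.solve-∀
  twice : ∀ n e r → n + (e * 2 + r) + n ≡ (n + e) * 2 + r
  twice = ℕSolver.solve-∀
  value : (((m + n) / 2) + 1) C 2 + ((((m ∸ n) + 1) / 2) + 1) C 2 ≡ tri (n + e) + tri (e + r)
  value = cong₂ _+_
    (trans (C2≡tri ((m + n) / 2)) (cong tri (trans (cong (_/ 2) (twice n e r)) (half (n + e) r r≤1))))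
    (trans (C2≡tri (((m ∸ n) + 1) / 2))
           (cong tri (trans (cong (λ z → (z + 1) / 2) (ℕP.m+n∸m≡n n (e * 2 + r))) (half-up e r r≤1))))

claim¹ : ∀ n₁ e → let n = suc n₁ ; m = n + (e * 2 + 1) in
         ((m + 2) / 2 ≤ (((m + n + 1) / 2) + 1) C 2 + (((m ∸ n) / 2) + 1) C 2)
         × d¹ n m (((((m + n + 1) / 2) + 1) C 2 + (((m ∸ n) / 2) + 1) C 2) ∸ ((m + 2) / 2))
claim¹ n₁ e with parity (suc (suc n₁))
... | c , ρ , ρ≤1 , split =
  subst₂ _≤_ (sym zeroAt) (sym value) (position-bound n e c c≤n) ,
  subst (d¹ n m) (sym (trans (cong₂ _∸_ value zeroAt) (subtract-position n e c c≤n)))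
    (distance-u¹ n₁ m e c c≤n n≤2c (shape n e) (half-difference n e 1 (s≤s z≤n)) zeroAt)
  where
  n m : ℕ
  n = suc n₁
  m = n + (e * 2 + 1)
  c≤n : c ≤ n
  c≤n = proj₁ (half-bounds n c ρ ρ≤1 split)
  n≤2c : n ≤ c + c
  n≤2c = proj₂ (half-bounds n c ρ ρ≤1 split)
  zeroAt : (m + 2) / 2 ≡ suc (e + c)
  zeroAt = zero-position n e c ρ ρ≤1 split
  shape : ∀ n e → n + (e * 2 + 1) ≡ suc ((n + e) + e)
  shape = ℕSolver.solve-∀
  twice : ∀ n e → n + (e * 2 + 1) + n + 1 ≡ suc (n + e) * 2 + 0
  twice = ℕSolver.solve-∀
  value : (((m + n + 1) / 2) + 1) C 2 + (((m ∸ n) / 2) + 1) C 2 ≡ tri (suc (n + e)) + tri e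
  value = cong₂ _+_
    (trans (C2≡tri ((m + n + 1) / 2)) (cong tri (trans (cong (_/ 2) (twice n e)) (half (suc (n + e)) 0 z≤n))))
    (trans (C2≡tri ((m ∸ n) / 2)) (cong tri (half-difference n e 1 (s≤s z≤n))))

even-difference : ∀ n e → (n + (e * 2 + 0) ∸ n) % 2 ≡ 0
even-difference n e =
  trans (cong (_% 2) (trans (ℕP.m+n∸m≡n n (e * 2 + 0)) (ℕP.+-identityʳ (e * 2)))) (m*n%n≡0 e 2)

-- Write m = n + (2e + r) with r ≤ 1; part (1) holds for both parities, and the
-- hypothesis of part (2) leaves only r = 1.
lemma5p22 : (n m : ℕ) → 1 < n → n ≤ m →
    d⁰ n m ((((m + n) / 2) + 1) C 2 + ((((m ∸ n) + 1) / 2) + 1) C 2)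
    × (n < m → (m ∸ n) % 2 ≢ 0 →
        ((m + 2) / 2 ≤ (((m + n + 1) / 2) + 1) C 2 + (((m ∸ n) / 2) + 1) C 2)
        × d¹ n m (((((m + n + 1) / 2) + 1) C 2 + (((m ∸ n) / 2) + 1) C 2) ∸ ((m + 2) / 2)))
lemma5p22 zero     m () n≤m
lemma5p22 (suc n₁) m _  n≤m with ℕP.m≤n⇒∃[o]m+o≡n n≤m
... | d , refl with parity d
... | e , zero          , _        , refl = claim⁰ n₁ e 0 z≤n , λ _ odd → ⊥-elim (odd (even-difference (suc n₁) e))
... | e , suc zero      , _        , refl = claim⁰ n₁ e 1 (s≤s z≤n) , λ _ _ → claim¹ n₁ e
... | e , suc (suc _)   , s≤s ()   , _
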